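{- Let $\mathbf x$ be an infinite word over a finite alphabet which is not ultimately periodic, and let $n \ge 1$ satisfy $p(n+1,\mathbf x) = p(n,\mathbf x)+1$. Then the reduced Rauzy graph $\mathcal G'_n(\mathbf x)$ has one of the following two forms: (a) it is of $\infty$-shape, i.e. it consists of one bispecial vertex $w$ and exactly two cycles from $w$ to itself; or (b) it has exactly one left-special vertex $u$ and exactly one right-special vertex $w \neq u$, and it consists of two paths from $w$ to $u$ (sharing only their endpoints) together with one path from $u$ to $w$. Moreover, in case (b), there exists a positive integer $d$ such that $\mathcal G'_{n+d}(\mathbf x)$ is of $\infty$-shape.
   Context: $p(m,\mathbf x)$ is the number of distinct factors of length $m$. A factor is recurrent if it occurs infinitely often; $\mathbf y$ is $m$-recurrent if all its factors of length $m$ are recurrent. $a_m$ is the shortest prefix of $\mathbf x$ with $\mathbf x = a_m\mathbf z_m$ and $\mathbf z_m$ $m$-recurrent. The Rauzy graph $\mathcal G_n(\mathbf y)$ of an infinite word $\mathbf y$ is the directed graph whose vertices are the factors of length $n$ of $\mathbf y$, with an edge from $u$ to $v$ iff there are letters $c,d$ with $uc = dv$ a factor of $\mathbf y$. The reduced Rauzy graph is $\mathcal G'_n(\mathbf x) := \mathcal G_n(\mathbf z_{n+1})$. A vertex $u$ is right-special (resp. left-special) in $\mathbf z_{n+1}$ if $uc, ud$ (resp. $cu,du$) are factors of $\mathbf z_{n+1}$ for distinct letters $c,d$; bispecial if both. $\mathcal G'_n(\mathbf x)$ is of $\infty$-shape if there is exactly one special (left- or right-special) word $w$ of length $n$ in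 $\mathbf z_{n+1}$ and there are exactly two paths from $w$ to itself not passing through $w$ in between. -}

module Defs where

open import Data.Nat using (ℕ; zero; suc; _+_; _≤_; _<_)
open import Data.Fin using (Fin)
open import Data.List using (List; []; _∷_; _++_; [_]; map; upTo; length)
open import Data.List.Membership.Propositional using (_∈_; _∉_)
open import Data.List.Relation.Unary.All using (All)
open import Data.List.Relation.Unary.Unique.Propositional using (Unique)
open import Data.Product using (Σ; ∃; ∃-syntax; _×_; _,_)
open import Data.Sum using (_⊎_)
open import Relation.Nullary using (¬_)
open import Relation.Binary.PropositionalEquality using (_≡_; _≢_)

InfWord : ℕ → Set
InfWord k = ℕ → Fin k

Word : ℕ → Set
Word k = List (Fin k)

factorAt : ∀ {k} → InfWord k → ℕ → ℕ → Word k
factorAt x i n = map (λ j → x (i + j)) (upTo n)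

shift : ∀ {k} → InfWord k → ℕ → InfWord k
shift x j i = x (j + i)

IsFactor : ∀ {k} → InfWord k → Word k → Set
IsFactor x w = ∃[ i ] factorAt x i (length w) ≡ w

UltPeriodic : ∀ {k} → InfWord k → Set
UltPeriodic x = ∃[ N ] ∃[ p ] (0 < p × (∀ i → N ≤ i → x (i + p) ≡ x i))

-- p(n, x) = m : the factors of length n of x are exactly the m distinct
-- words in some duplicate-free list of length m.
HasComplexity : ∀ {k} → InfWord k → ℕ → ℕ → Set
HasComplexity {k} x n m =
  Σ (List (Word k)) λ L →
    length L ≡ m × Unique L ×
    All (λ w → length w ≡ n × IsFactor x w) L ×
    (∀ w → length w ≡ n → IsFactor x w → w ∈ L)

Recurrent : ∀ {k} → InfWord k → Word k → Set
Recurrent x w = ∀ N → ∃[ i ] (N ≤ i × factorAt x i (length w) ≡ w)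

MRecurrent : ∀ {k} → ℕ → InfWord k → Set
MRecurrent {k} m y = ∀ (w : Word k) → length w ≡ m → IsFactor y w → Recurrent y w

-- j = |a_m|: the suffix z_m = shift x j is m-recurrent and no shorter prefix works.
IsPrefixLength : ∀ {k} → ℕ → InfWord k → ℕ → Set
IsPrefixLength m x j =
  MRecurrent m (shift x j) × (∀ j' → j' < j → ¬ MRecurrent m (shift x j'))

-- Rauzy graph G_n(y): vertices = factors of length n of y,
-- edge u → v iff uc = dv is a factor of y for some letters c, d.

Vertex : ∀ {k} → InfWord k → ℕ → Word k → Set
Vertex y n u = length u ≡ n × IsFactor y u

Edge : ∀ {k} → InfWord k → ℕ → Word k → Word k → Set
Edge {k} y n u v =
  length u ≡ n × length v ≡ n ×
  Σ (Fin k) λ c → Σ (Fin k) λ d → (u ++ [ c ] ≡ d ∷ v) × IsFactor y (u ++ [ c ])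

data Walk {k} (y : InfWord k) (n : ℕ) : Word k → Word k → List (Word k) → Set where
  here : ∀ {s} → Vertex y n s → Walk y n s s (s ∷ [])
  step : ∀ {s v t P} → Edge y n s v → Walk y n v t P → Walk y n s t (s ∷ P)

Path : ∀ {k} → InfWord k → ℕ → Word k → Word k → List (Word k) → Set
Path y n s t P = Walk y n s t P × Unique P

Cycle : ∀ {k} → InfWord k → ℕ → Word k → List (Word k) → Set
Cycle {k} y n w P =
  Walk y n w w P ×
  Σ (List (Word k)) λ inner → (P ≡ w ∷ inner ++ [ w ]) × w ∉ inner × Unique inner

RightSpecial : ∀ {k} → InfWord k → Word k → Set
RightSpecial {k} y u = Σ (Fin k) λ c → Σ (Fin k) λ d →
  c ≢ d × IsFactor y (u ++ [ c ]) × IsFactor y (u ++ [ d ])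

LeftSpecial : ∀ {k} → InfWord k → Word k → Set
LeftSpecial {k} y u = Σ (Fin k) λ c → Σ (Fin k) λ d →
  c ≢ d × IsFactor y (c ∷ u) × IsFactor y (d ∷ u)

Special : ∀ {k} → InfWord k → Word k → Set
Special y u = LeftSpecial y u ⊎ RightSpecial y u

Bispecial : ∀ {k} → InfWord k → Word k → Set
Bispecial y u = LeftSpecial y u × RightSpecial y u

Consecutive : ∀ {k} → Word k → Word k → List (Word k) → Set
Consecutive {k} a b P =
  Σ (List (Word k)) λ l → Σ (List (Word k)) λ r → P ≡ l ++ a ∷ b ∷ r

InfShapeAt : ∀ {k} → InfWord k → ℕ → Word k → Set
InfShapeAt {k} y n w =
  length w ≡ n × Special y w ×
  (∀ v → length v ≡ n → Special y v → v ≡ w) ×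
  Σ (List (Word k)) λ P₁ → Σ (List (Word k)) λ P₂ →
    P₁ ≢ P₂ × Cycle y n w P₁ × Cycle y n w P₂ ×
    (∀ P → Cycle y n w P → P ≡ P₁ ⊎ P ≡ P₂)

InfShape : ∀ {k} → InfWord k → ℕ → Set
InfShape {k} y n = Σ (Word k) λ w → InfShapeAt y n w

FormA : ∀ {k} → InfWord k → ℕ → Set
FormA {k} y n = Σ (Word k) λ w → InfShapeAt y n w × Bispecial y w

FormB : ∀ {k} → InfWord k → ℕ → Set
FormB {k} y n =
  Σ (Word k) λ u → Σ (Word k) λ w →
    length u ≡ n × length w ≡ n × u ≢ w ×
    LeftSpecial y u × (∀ v → length v ≡ n → LeftSpecial y v → v ≡ u) ×
    RightSpecial y w × (∀ v → length v ≡ n → RightSpecial y v → v ≡ w) ×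
    Σ (List (Word k)) λ P₁ → Σ (List (Word k)) λ P₂ → Σ (List (Word k)) λ Q →
      Path y n w u P₁ × Path y n w u P₂ × P₁ ≢ P₂ ×
      (∀ v → v ∈ P₁ → v ∈ P₂ → v ≡ w ⊎ v ≡ u) ×
      Path y n u w Q ×
      (∀ v → Vertex y n v → v ∈ P₁ ⊎ v ∈ P₂ ⊎ v ∈ Q) ×
      (∀ a b → Edge y n a b →
         Consecutive a b P₁ ⊎ Consecutive a b P₂ ⊎ Consecutive a b Q)

-- Since p(n+1) = p(n) + 1, choosing one right extension of every factor of length n leaves
-- exactly one factor of length n+1 unchosen. Hence x has a unique right-special factor w of
-- length n, with exactly two right extensions a and b. In the (n+1)-recurrent suffix y = z_{n+1}
-- some vertex must branch (otherwise a repeated window would make x ultimately periodic), so w is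
-- the only right-special vertex of G_n(y) and both wa and wb occur in y.
-- Off w the graph is deterministic, so the first returns to w along a and along b are the only
-- two cycles through w, and by recurrence they cover every edge. The vertex u where the a-cycle
-- first enters the b-cycle is the unique left-special vertex. If u = w we are in case (a);
-- otherwise the graph consists of the two paths w → u and the common path u → w, of some
-- length d > 0 (case (b)). Every occurrence of u is followed, and every occurrence of w is
-- preceded, by the word W read along u → w; so W is the unique left- and right-special factor of
-- length n + d of z_{n+d+1}, where the same construction now has u = w and gives an ∞-shape.

module Submission where

open import Defs
open import Data.Empty using (⊥; ⊥-elim)
open import Data.Fin using (Fin; toℕ)
import Data.Fin.Properties as Fin
open import Data.List using (List; []; _∷_; _++_; [_]; length; lookup; applyUpTo)
import Data.List.Properties as List
open import Data.List.Membership.Propositional using (_∈_; _∉_; _─_; find)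
open import Data.List.Membership.Propositional.Properties using (∈-applyUpTo⁺; ∈-applyUpTo⁻)
open import Data.List.Relation.Unary.All using (All; []; _∷_)
import Data.List.Relation.Unary.All as All
open import Data.List.Relation.Unary.AllPairs using ([]; _∷_)
open import Data.List.Relation.Unary.Any using (here; there; index; any?)
import Data.List.Relation.Unary.Any as Any
open import Data.List.Relation.Unary.Any.Properties using (lookup-index)
open import Data.List.Relation.Unary.Unique.Propositional using (Unique)
open import Data.List.Relation.Unary.Unique.Propositional.Properties using (applyUpTo⁺₁)
open import Data.Nat using (ℕ; zero; suc; _+_; _∸_; _≤_; _<_; z≤n; s≤s; z<s; NonZero; >-nonZero; >-nonZero⁻¹; _<?_; _≤?_; _≟_)
open import Data.Nat.Induction using (<-rec)
open import Data.Nat.Properties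
open import Data.Nat.Tactic.RingSolver using (solve-∀)
open import Data.Product using (Σ; ∃-syntax; _×_; _,_; proj₁; proj₂)
open import Data.Sum using (_⊎_; inj₁; inj₂)
import Data.Sum as Sum
open import Function using (_∘_; case_of_)
open import Relation.Binary.Definitions using (tri<; tri≈; tri>)
open import Relation.Nullary using (¬_; Dec; yes; no; ¬?)
open import Relation.Binary.PropositionalEquality hiding ([_])

_≟ʷ_ : ∀ {k} (u v : Word k) → Dec (u ≡ v)
_≟ʷ_ = List.≡-dec Fin._≟_

length-∷ʳ : ∀ {k n} (v : Word k) c → length v ≡ n → length (v ++ [ c ]) ≡ suc n
length-∷ʳ v c refl = trans (List.length-++ v) (+-comm (length v) 1)

∸-split : ∀ {m n} → m ≤ n → ∃[ d ] n ≡ m + d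
∸-split {m} {n} m≤n = n ∸ m , sym (m+[n∸m]≡n m≤n)

module _ {P : ℕ → Set} (P? : ∀ s → Dec (P s)) where

  least : ∀ b → P b → ∃[ s ] s ≤ b × P s × (∀ s' → s' < s → ¬ P s')
  least b pb =
    let s , s≤ , ps , min = search b 0 (λ _ ()) (subst P (sym (+-identityʳ b)) pb)
    in s , subst (s ≤_) (+-identityʳ b) s≤ , ps , min
    where
    search : ∀ f a → (∀ s' → s' < a → ¬ P s') → P (f + a) →
             ∃[ s ] s ≤ f + a × P s × (∀ s' → s' < s → ¬ P s')
    search f a below p with P? a
    ... | yes pa = a , m≤n+m a f , pa , below
    search zero a below p | no ¬pa = ⊥-elim (¬pa p)
    search (suc f) a below p | no ¬pa =
      let s , s≤ , ps , min = search f (suc a) below' (subst P (sym (+-suc f a)) p)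
      in s , subst (s ≤_) (+-suc f a) s≤ , ps , min
      where
      below' : ∀ s' → s' < suc a → ¬ P s'
      below' s' s'<1+a with m≤n⇒m<n∨m≡n (≤-pred s'<1+a)
      ... | inj₁ s'<a = below s' s'<a
      ... | inj₂ refl = ¬pa

  ∃≤? : ∀ b → Dec (∃[ r ] r ≤ b × P r)
  ∃≤? zero with P? 0
  ... | yes p = yes (0 , z≤n , p)
  ... | no ¬p = no λ { (.0 , z≤n , p) → ¬p p }
  ∃≤? (suc b) with P? (suc b) | ∃≤? b
  ... | yes p | _ = yes (suc b , ≤-refl , p)
  ... | no _  | yes (r , r≤b , p) = yes (r , m≤n⇒m≤1+n r≤b , p)
  ... | no ¬p | no ¬e = no λ (r , r≤1+b , p) → case m≤n⇒m<n∨m≡n r≤1+b of λ where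
    (inj₁ r<1+b) → ¬e (r , ≤-pred r<1+b , p)
    (inj₂ refl)  → ¬p p

∈-─⁺ : ∀ {A : Set} {x z : A} xs (x∈xs : x ∈ xs) → z ∈ xs → z ≢ x → z ∈ xs ─ x∈xs
∈-─⁺ (y ∷ xs) (here refl) (here refl)  z≢x = ⊥-elim (z≢x refl)
∈-─⁺ (y ∷ xs) (here refl) (there z∈xs) z≢x = z∈xs
∈-─⁺ (y ∷ xs) (there x∈xs) (here z≡y) z≢x = here z≡y
∈-─⁺ (y ∷ xs) (there x∈xs) (there z∈xs) z≢x = there (∈-─⁺ xs x∈xs z∈xs z≢x)

unique-⊆⇒length-≤ : ∀ {A : Set} (xs ys : List A) → Unique xs → (∀ {z} → z ∈ xs → z ∈ ys) → length xs ≤ length ys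
unique-⊆⇒length-≤ [] ys _ _ = z≤n
unique-⊆⇒length-≤ (x ∷ xs) ys (x∉xs ∷ uniq) xs⊆ys = begin
  suc (length xs)           ≤⟨ s≤s (unique-⊆⇒length-≤ xs (ys ─ x∈ys) uniq xs⊆ys─x) ⟩
  suc (length (ys ─ x∈ys))  ≡⟨ sym (List.length-removeAt′ ys _) ⟩
  length ys                 ∎
  where
  open ≤-Reasoning
  x∈ys = xs⊆ys (here refl)
  xs⊆ys─x : ∀ {z} → z ∈ xs → z ∈ ys ─ x∈ys
  xs⊆ys─x z∈xs = ∈-─⁺ ys x∈ys (xs⊆ys (there z∈xs)) (λ z≡x → All.lookup x∉xs z∈xs (sym z≡x))

factor : ∀ {k} → InfWord k → ℕ → ℕ → Word k
factor y i zero    = []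
factor y i (suc n) = y i ∷ factor y (suc i) n

module _ {k : ℕ} (y : InfWord k) where

  applyUpTo-factor : ∀ n i (f : ℕ → Fin k) → (∀ r → f r ≡ y (i + r)) → applyUpTo f n ≡ factor y i n
  applyUpTo-factor zero    i f f≗ = refl
  applyUpTo-factor (suc n) i f f≗ = cong₂ _∷_
    (trans (f≗ 0) (cong y (+-identityʳ i)))
    (applyUpTo-factor n (suc i) (λ r → f (suc r)) (λ r → trans (f≗ (suc r)) (cong y (+-suc i r))))

  factorAt≡factor : ∀ i n → factorAt y i n ≡ factor y i n
  factorAt≡factor i n = trans (List.map-applyUpTo (λ r → r) (λ r → y (i + r)) n)
                              (applyUpTo-factor n i _ (λ r → refl))

  length-factor : ∀ i n → length (factor y i n) ≡ n
  length-factor i zero    = refl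
  length-factor i (suc n) = cong suc (length-factor (suc i) n)

  factor-++ : ∀ i a b → factor y i (a + b) ≡ factor y i a ++ factor y (i + a) b
  factor-++ i zero    b = cong (λ p → factor y p b) (sym (+-identityʳ i))
  factor-++ i (suc a) b = cong (y i ∷_) (trans (factor-++ (suc i) a b)
                                               (cong (λ p → factor y (suc i) a ++ factor y p b) (sym (+-suc i a))))

  factor-∷ʳ : ∀ i n → factor y i (suc n) ≡ factor y i n ++ [ y (i + n) ]
  factor-∷ʳ i n = trans (cong (factor y i) (+-comm 1 n)) (factor-++ i n 1)

  factor-isFactor : ∀ i n → IsFactor y (factor y i n)
  factor-isFactor i n = i , trans (cong (factorAt y i) (length-factor i n)) (factorAt≡factor i n)

  factor-∷ʳ-isFactor : ∀ i n → IsFactor y (factor y i n ++ [ y (i + n) ])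
  factor-∷ʳ-isFactor i n = subst (IsFactor y) (factor-∷ʳ i n) (factor-isFactor i (suc n))

  isFactor⇒factor : ∀ {w} → IsFactor y w → ∃[ i ] factor y i (length w) ≡ w
  isFactor⇒factor (i , eq) = i , trans (sym (factorAt≡factor i _)) eq

  isFactor⇒factorOfLength : ∀ {u n} → length u ≡ n → IsFactor y u → ∃[ i ] factor y i n ≡ u
  isFactor⇒factorOfLength refl = isFactor⇒factor

  isFactor-∷ʳ⇒factor : ∀ {u c n} → length u ≡ n → IsFactor y (u ++ [ c ]) →
                       ∃[ i ] factor y i n ≡ u × y (i + n) ≡ c
  isFactor-∷ʳ⇒factor {u} {c} {n} refl uc =
    let i , eq = isFactor⇒factor uc
    in i , List.∷ʳ-injective (factor y i n) u
             (trans (sym (factor-∷ʳ i n)) (trans (cong (factor y i) (sym (length-∷ʳ u c refl))) eq))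

  isFactor-∷⇒factor : ∀ {u c n} → length u ≡ n → IsFactor y (c ∷ u) →
                      ∃[ i ] y i ≡ c × factor y (suc i) n ≡ u
  isFactor-∷⇒factor refl cu = let i , eq = isFactor⇒factor cu in i , List.∷-injective eq

  factor-split : ∀ i i' a b → factor y i (a + b) ≡ factor y i' (a + b) →
                 factor y i a ≡ factor y i' a × factor y (i + a) b ≡ factor y (i' + a) b
  factor-split i i' zero b eq =
    refl , subst₂ (λ p p' → factor y p b ≡ factor y p' b) (sym (+-identityʳ i)) (sym (+-identityʳ i')) eq
  factor-split i i' (suc a) b eq =
    let head , rest = List.∷-injective eq
        init , tail = factor-split (suc i) (suc i') a b rest
    in cong₂ _∷_ head init ,
       subst₂ (λ p p' → factor y p b ≡ factor y p' b) (sym (+-suc i a)) (sym (+-suc i' a)) tail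

  factor-∷ʳ-injective : ∀ {i i' n} → factor y i (suc n) ≡ factor y i' (suc n) →
                        factor y i n ≡ factor y i' n × y (i + n) ≡ y (i' + n)
  factor-∷ʳ-injective {i} {i'} {n} eq = List.∷ʳ-injective (factor y i n) (factor y i' n)
    (trans (sym (factor-∷ʳ i n)) (trans eq (factor-∷ʳ i' n)))

  factor-step : ∀ {i i' n} → factor y i n ≡ factor y i' n → y (i + n) ≡ y (i' + n) →
                factor y (suc i) n ≡ factor y (suc i') n
  factor-step {i} {i'} {n} eq next = List.∷-injectiveʳ (begin
    factor y i (suc n)                  ≡⟨ factor-∷ʳ i n ⟩
    factor y i n ++ [ y (i + n) ]       ≡⟨ cong₂ (λ u c → u ++ [ c ]) eq next ⟩
    factor y i' n ++ [ y (i' + n) ]     ≡⟨ factor-∷ʳ i' n ⟨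
    factor y i' (suc n)                 ∎)
    where open ≡-Reasoning

  factor-stepBack : ∀ {i i' n} → y i ≡ y i' → factor y (suc i) n ≡ factor y (suc i') n →
                    factor y i n ≡ factor y i' n
  factor-stepBack {i} {i'} {n} first eq = proj₁ (factor-∷ʳ-injective (cong₂ _∷_ first eq))

  factor-head : ∀ {i i'} n → .⦃ _ : NonZero n ⦄ → factor y i n ≡ factor y i' n → y i ≡ y i'
  factor-head (suc n) eq = List.∷-injectiveˡ eq

  factor-last : ∀ {i i'} n → .⦃ _ : NonZero n ⦄ → factor y (suc i) n ≡ factor y (suc i') n →
                y (i + n) ≡ y (i' + n)
  factor-last {i} {i'} (suc n) eq = begin
    y (i + suc n)   ≡⟨ cong y (+-suc i n) ⟩
    y (suc i + n)   ≡⟨ proj₂ (factor-∷ʳ-injective eq) ⟩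
    y (suc i' + n)  ≡⟨ cong y (+-suc i' n) ⟨
    y (i' + suc n)  ∎
    where open ≡-Reasoning

  factor-from-windows : ∀ {a b} e n → .⦃ _ : NonZero n ⦄ →
                        (∀ z → z ≤ e → factor y (a + z) n ≡ factor y (b + z) n) → factor y a (e + n) ≡ factor y b (e + n)
  factor-from-windows {a} {b} zero n agree =
    subst₂ (λ a' b' → factor y a' n ≡ factor y b' n) (+-identityʳ a) (+-identityʳ b) (agree 0 z≤n)
  factor-from-windows {a} {b} (suc e) n agree =
    cong₂ _∷_ (subst₂ (λ a' b' → y a' ≡ y b') (+-identityʳ a) (+-identityʳ b) (factor-head n (agree 0 z≤n)))
              (factor-from-windows e n λ z z≤e →
                 subst₂ (λ a' b' → factor y a' n ≡ factor y b' n) (+-suc a z) (+-suc b z) (agree (suc z) (s≤s z≤e)))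

factor-shift : ∀ {k} (x : InfWord k) a i n → factor (shift x a) i n ≡ factor x (a + i) n
factor-shift x a i zero    = refl
factor-shift x a i (suc n) = cong (x (a + i) ∷_) (trans (factor-shift x a (suc i) n) (cong (λ p → factor x p n) (+-suc a i)))

repeated-factor : ∀ {k} (y : InfWord k) n (L : List (Word k)) → (∀ i → factor y i n ∈ L) →
                  ∃[ i ] ∃[ i' ] i < i' × factor y i n ≡ factor y i' n
repeated-factor y n L in-L =
  let i , i' , i<i' , same = Fin.pigeonhole (n<1+n (length L)) (λ r → index (in-L (toℕ r)))
  in toℕ i , toℕ i' , i<i' ,
     trans (lookup-index (in-L (toℕ i))) (trans (cong (lookup L) same) (sym (lookup-index (in-L (toℕ i')))))

repeat⇒ultPeriodic : ∀ {k} (y : InfWord k) n .⦃ _ : NonZero n ⦄ →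
                     (∀ {i i'} → factor y i n ≡ factor y i' n → y (i + n) ≡ y (i' + n)) →
                     ∀ {i i'} → i < i' → factor y i n ≡ factor y i' n → UltPeriodic y
repeat⇒ultPeriodic y n determined {i} {i'} i<i' same = i , δ , δ>0 , periodic
  where
  δ = proj₁ (∸-split (<⇒≤ i<i'))
  i'≡ = proj₂ (∸-split (<⇒≤ i<i'))
  δ>0 : 0 < δ
  δ>0 = +-cancelˡ-< i 0 δ (subst₂ _<_ (sym (+-identityʳ i)) i'≡ i<i')
  windows : ∀ s → factor y (i + s) n ≡ factor y (i' + s) n
  windows zero    = subst₂ (λ a b → factor y a n ≡ factor y b n) (sym (+-identityʳ i)) (sym (+-identityʳ i')) same
  windows (suc s) = subst₂ (λ a b → factor y a n ≡ factor y b n) (sym (+-suc i s)) (sym (+-suc i' s))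
                      (factor-step y (windows s) (determined (windows s)))
  periodic : ∀ t → i ≤ t → y (t + δ) ≡ y t
  periodic t i≤t with s , refl ← ∸-split i≤t =
    trans (cong y (trans (+-assoc i s δ) (trans (cong (i +_) (+-comm s δ)) (trans (sym (+-assoc i δ s)) (cong (_+ s) (sym i'≡))))))
          (sym (factor-head y n (windows s)))

shift-ultPeriodic : ∀ {k} (x : InfWord k) j → UltPeriodic (shift x j) → UltPeriodic x
shift-ultPeriodic x j (N , p , p>0 , periodic) = j + N , p , p>0 , λ t j+N≤t →
  let s , t≡ = ∸-split j+N≤t in
  subst (λ t' → x (t' + p) ≡ x t') (sym t≡)
    (trans (cong x (trans (cong (_+ p) (+-assoc j N s)) (+-assoc j (N + s) p))) (trans (periodic (N + s) (m≤m+n N s)) (cong x (sym (+-assoc j N s)))))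

mRecurrent-shorter : ∀ {k} (z : InfWord k) a b → MRecurrent (a + b) z → MRecurrent a z
mRecurrent-shorter z a b recurrent v refl (i , eq) M =
  let i' , M≤i' , eq' = recurrent (factor z i (a + b)) (length-factor z i (a + b)) (factor-isFactor z i (a + b)) M
      long = trans (sym (factorAt≡factor z i' (a + b))) (trans (cong (factorAt z i') (sym (length-factor z i (a + b)))) eq')
  in i' , M≤i' , trans (factorAt≡factor z i' a) (trans (proj₁ (factor-split z i' i a b long)) (trans (sym (factorAt≡factor z i a)) eq))

prefix-isFactor : ∀ {k} {y : InfWord k} {u c} → IsFactor y (u ++ [ c ]) → IsFactor y u
prefix-isFactor {y = y} {u} uc = let i , eq , _ = isFactor-∷ʳ⇒factor y refl uc in subst (IsFactor y) eq (factor-isFactor y i (length u))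

suffix-isFactor : ∀ {k} {y : InfWord k} {u c} → IsFactor y (c ∷ u) → IsFactor y u
suffix-isFactor {y = y} {u} cu = let i , _ , eq = isFactor-∷⇒factor y refl cu in subst (IsFactor y) eq (factor-isFactor y (suc i) (length u))

applyUpTo-consecutive : ∀ {k} (f : ℕ → Word k) → ∀ {r L} → r < L → Consecutive (f r) (f (suc r)) (applyUpTo f (suc L))
applyUpTo-consecutive f {zero}  {suc L} _ = [] , applyUpTo (f ∘ suc ∘ suc) L , refl
applyUpTo-consecutive f {suc r} {suc L} (s≤s r<L) =
  let l , l' , eq = applyUpTo-consecutive (f ∘ suc) r<L in f 0 ∷ l , l' , cong (f 0 ∷_) eq

module _ {k : ℕ} {y : InfWord k} {n : ℕ} where

  walk-subst : ∀ {s s' t t' P P'} → s ≡ s' → t ≡ t' → P ≡ P' → Walk y n s t P → Walk y n s' t' P'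
  walk-subst refl refl refl W = W

  walk-nonEmpty : ∀ {s t P} → Walk y n s t P → P ≢ []
  walk-nonEmpty (here _)   ()
  walk-nonEmpty (step _ _) ()

  edge-source : ∀ {u v} → Edge y n u v → Vertex y n u
  edge-source (ℓu , _ , _ , _ , _ , uc) = ℓu , prefix-isFactor {y = y} uc

  applyUpTo-walk : (f : ℕ → Word k) → (∀ r → Edge y n (f r) (f (suc r))) →
                   ∀ L → Walk y n (f 0) (f L) (applyUpTo f (suc L))
  applyUpTo-walk f edges zero    = here (edge-source (edges 0))
  applyUpTo-walk f edges (suc L) = step (edges 0) (applyUpTo-walk (f ∘ suc) (edges ∘ suc) L)

  walk-follows : ∀ {w} (f : ℕ → Word k) → (∀ {r v} → f r ≢ w → Edge y n (f r) v → v ≡ f (suc r)) →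
                 ∀ xs {s P} → Walk y n s w P → s ≡ f 0 → P ≡ xs ++ [ w ] → w ∉ xs →
                 xs ≡ applyUpTo f (length xs) × f (length xs) ≡ w
  walk-follows f next [] (here _) refl eq _ = refl , sym (List.∷-injectiveˡ eq)
  walk-follows f next [] (step _ W) refl eq _ = ⊥-elim (walk-nonEmpty W (List.∷-injectiveʳ eq))
  walk-follows f next (x ∷ xs) (here _) refl eq _ with () ← List.++-conicalʳ xs _ (sym (List.∷-injectiveʳ eq))
  walk-follows f next (x ∷ xs) (step e W) refl eq w∉ =
    let f0≡x = List.∷-injectiveˡ eq
        f0≢w = λ f0≡w → w∉ (here (trans (sym f0≡w) f0≡x))
        xs≡ , end = walk-follows (f ∘ suc) next xs W (next f0≢w e) (List.∷-injectiveʳ eq) (w∉ ∘ there)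
    in cong₂ _∷_ (sym f0≡x) xs≡ , end

module FirstExtensions {k : ℕ} (x : InfWord k) (n : ℕ) where

  FactorOfLength : ℕ → Word k → Set
  FactorOfLength ℓ w = length w ≡ ℓ × IsFactor x w

  extendAll : ∀ {vs} → All (FactorOfLength n) vs → List (Word k)
  extendAll []                  = []
  extendAll ((_ , i , _) ∷ pvs) = factor x i (suc n) ∷ extendAll pvs

  length-extendAll : ∀ {vs} (pvs : All (FactorOfLength n) vs) → length (extendAll pvs) ≡ length vs
  length-extendAll []        = refl
  length-extendAll (_ ∷ pvs) = cong suc (length-extendAll pvs)

  extension-∷ʳ : ∀ {v} (pv : FactorOfLength n v) → ∃[ c ] extendAll (pv ∷ []) ≡ [ v ++ [ c ] ]
  extension-∷ʳ (refl , i , eq) = x (i + _) ,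
    cong [_] (trans (factor-∷ʳ x i _) (cong (_++ [ x (i + _) ]) (trans (sym (factorAt≡factor x i _)) eq)))

  ∈-extendAll⁻ : ∀ {vs z} (pvs : All (FactorOfLength n) vs) → z ∈ extendAll pvs →
                 ∃[ v ] ∃[ c ] z ≡ v ++ [ c ] × v ∈ vs
  ∈-extendAll⁻ (pv ∷ pvs) (here refl) = let c , eq = extension-∷ʳ pv in _ , c , List.∷-injectiveˡ eq , here refl
  ∈-extendAll⁻ (pv ∷ pvs) (there z∈) = let v , c , eq , v∈ = ∈-extendAll⁻ pvs z∈ in v , c , eq , there v∈

  ∈-extendAll⁺ : ∀ {vs v} (pvs : All (FactorOfLength n) vs) → v ∈ vs → ∃[ c ] v ++ [ c ] ∈ extendAll pvs
  ∈-extendAll⁺ (pv ∷ pvs) (here refl) = let c , eq = extension-∷ʳ pv in c , here (sym (List.∷-injectiveˡ eq))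
  ∈-extendAll⁺ (pv ∷ pvs) (there v∈) = let c , c∈ = ∈-extendAll⁺ pvs v∈ in c , there c∈

  extendAll-factors : ∀ {vs} (pvs : All (FactorOfLength n) vs) → All (FactorOfLength (suc n)) (extendAll pvs)
  extendAll-factors []                  = []
  extendAll-factors ((_ , i , _) ∷ pvs) = (length-factor x i (suc n) , factor-isFactor x i (suc n)) ∷ extendAll-factors pvs

  prefix∈ : ∀ {vs v c} (pvs : All (FactorOfLength n) vs) → v ++ [ c ] ∈ extendAll pvs → v ∈ vs
  prefix∈ pvs vc∈ = let _ , _ , eq , v'∈ = ∈-extendAll⁻ pvs vc∈ in
    subst (_∈ _) (sym (List.∷ʳ-injectiveˡ _ _ eq)) v'∈

  extension∉tail : ∀ {v₀ vs v c d} (pv : FactorOfLength n v₀) (pvs : All (FactorOfLength n) vs) →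
                   All (v₀ ≢_) vs → v ++ [ c ] ∈ extendAll (pv ∷ []) → v ++ [ d ] ∉ extendAll pvs
  extension∉tail pv pvs v₀∉ c∈ d∈ with prefix∈ (pv ∷ []) c∈
  ... | here refl = All.lookup v₀∉ (prefix∈ pvs d∈) refl

  extendAll-functional : ∀ {vs v c d} (pvs : All (FactorOfLength n) vs) → Unique vs →
                         v ++ [ c ] ∈ extendAll pvs → v ++ [ d ] ∈ extendAll pvs → c ≡ d
  extendAll-functional (pv ∷ pvs) _          (here eq)  (here eq') = List.∷ʳ-injectiveʳ _ _ (trans eq (sym eq'))
  extendAll-functional (pv ∷ pvs) (v∉ ∷ _)   (here eq)  (there d∈) = ⊥-elim (extension∉tail pv pvs v∉ (here eq) d∈)
  extendAll-functional (pv ∷ pvs) (v∉ ∷ _)   (there c∈) (here eq)  = ⊥-elim (extension∉tail pv pvs v∉ (here eq) c∈)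
  extendAll-functional (pv ∷ pvs) (_ ∷ uniq) (there c∈) (there d∈) = extendAll-functional pvs uniq c∈ d∈

  extendAll-unique : ∀ {vs} (pvs : All (FactorOfLength n) vs) → Unique vs → Unique (extendAll pvs)
  extendAll-unique []         []          = []
  extendAll-unique (pv ∷ pvs) (v∉ ∷ uniq) = All.tabulate head≢ ∷ extendAll-unique pvs uniq
    where
    head≢ : ∀ {z} → z ∈ extendAll pvs → _ ≢ z
    head≢ z∈ refl = let c , eq = extension-∷ʳ pv in
      extension∉tail pv pvs v∉ (here (List.∷-injectiveˡ (sym eq))) (subst (_∈ _) (List.∷-injectiveˡ eq) z∈)

module ComplexityGapOne {k : ℕ} (x : InfWord k) (n m : ℕ)
  (p[n] : HasComplexity x n m) (p[1+n] : HasComplexity x (suc n) (suc m)) where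

  open FirstExtensions x n
  open import Data.List.Membership.DecPropositional (_≟ʷ_ {k}) using (_∈?_)

  private
    L  = proj₁ p[n]
    L' = proj₁ p[1+n]
    length-L  = proj₁ (proj₂ p[n])
    length-L' = proj₁ (proj₂ p[1+n])
    L-factors  = proj₁ (proj₂ (proj₂ (proj₂ p[n])))
    L'-factors = proj₁ (proj₂ (proj₂ (proj₂ p[1+n])))
    L'-unique  = proj₁ (proj₂ (proj₂ p[1+n]))
    L-complete = proj₂ (proj₂ (proj₂ (proj₂ p[n])))
    L'-complete = proj₂ (proj₂ (proj₂ (proj₂ p[1+n])))

  -- m of the m + 1 factors of length n + 1, so exactly one of them is not chosen.
  chosen : List (Word k)
  chosen = extendAll L-factors

  length-chosen : length chosen ≡ m
  length-chosen = trans (length-extendAll L-factors) length-L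

  chosen-functional : ∀ {v c d} → v ++ [ c ] ∈ chosen → v ++ [ d ] ∈ chosen → c ≡ d
  chosen-functional = extendAll-functional L-factors (proj₁ (proj₂ (proj₂ p[n])))

  chosen⊆L' : ∀ {z} → z ∈ chosen → z ∈ L'
  chosen⊆L' z∈ = let ℓ , f = All.lookup (extendAll-factors L-factors) z∈ in L'-complete _ ℓ f

  outside-unique : ∀ {e e'} → FactorOfLength (suc n) e → FactorOfLength (suc n) e' → e ∉ chosen → e' ∉ chosen → e ≡ e'
  outside-unique {e} {e'} (ℓ , f) (ℓ' , f') e∉ e'∉ with e ≟ʷ e'
  ... | yes e≡e' = e≡e'
  ... | no  e≢e' = ⊥-elim (<⇒≱ (n<1+n (suc m)) (begin
    suc (suc m)             ≡⟨ cong (suc ∘ suc) length-chosen ⟨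
    length (e ∷ e' ∷ chosen)     ≤⟨ unique-⊆⇒length-≤ (e ∷ e' ∷ chosen) L' uniq sub ⟩
    length L'               ≡⟨ length-L' ⟩
    suc m                   ∎))
    where
    open ≤-Reasoning
    uniq : Unique (e ∷ e' ∷ chosen)
    uniq = (e≢e' ∷ All.tabulate (λ z∈ e≡z → e∉ (subst (_∈ chosen) (sym e≡z) z∈)))
         ∷ All.tabulate (λ z∈ e'≡z → e'∉ (subst (_∈ chosen) (sym e'≡z) z∈))
         ∷ extendAll-unique L-factors (proj₁ (proj₂ (proj₂ p[n])))
    sub : ∀ {z} → z ∈ e ∷ e' ∷ chosen → z ∈ L'
    sub (here refl)         = L'-complete e ℓ f
    sub (there (here refl)) = L'-complete e' ℓ' f'
    sub (there (there z∈))  = chosen⊆L' z∈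

  some-outside : ∃[ e ] FactorOfLength (suc n) e × e ∉ chosen
  some-outside with any? (λ z → ¬? (z ∈? chosen)) L'
  ... | yes ∃∉ = let e , e∈ , e∉ = find ∃∉ in e , All.lookup L'-factors e∈ , e∉
  ... | no  ∄∉ = ⊥-elim (<⇒≱ (n<1+n m) (begin
    suc m       ≡⟨ length-L' ⟨
    length L'   ≤⟨ unique-⊆⇒length-≤ L' chosen L'-unique L'⊆chosen ⟩
    length chosen    ≡⟨ length-chosen ⟩
    m           ∎))
    where
    open ≤-Reasoning
    L'⊆chosen : ∀ {z} → z ∈ L' → z ∈ chosen
    L'⊆chosen {z} z∈ with z ∈? chosen
    ... | yes z∈chosen = z∈chosen
    ... | no  z∉chosen = ⊥-elim (∄∉ (Any.map (λ { refl → z∉chosen }) z∈))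

  outside-extension : ∀ {v} → RightSpecial x v → ∃[ e ] IsFactor x (v ++ [ e ]) × v ++ [ e ] ∉ chosen
  outside-extension {v} (c , d , c≢d , fc , fd) with (v ++ [ c ]) ∈? chosen
  ... | no  c∉ = c , fc , c∉
  ... | yes c∈ = d , fd , λ d∈ → c≢d (chosen-functional c∈ d∈)

  outside-letters-equal : ∀ {v c d} → length v ≡ n → IsFactor x (v ++ [ c ]) → IsFactor x (v ++ [ d ]) →
                          v ++ [ c ] ∉ chosen → v ++ [ d ] ∉ chosen → c ≡ d
  outside-letters-equal {v} {c} {d} ℓ fc fd c∉ d∉ =
    List.∷ʳ-injectiveʳ v v (outside-unique (length-∷ʳ v c ℓ , fc) (length-∷ʳ v d ℓ , fd) c∉ d∉)

  rightSpecial-unique : ∀ {v v'} → length v ≡ n → length v' ≡ n → RightSpecial x v → RightSpecial x v' → v ≡ v'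
  rightSpecial-unique {v} {v'} ℓ ℓ' rs rs' =
    let e , fe , e∉ = outside-extension rs
        e' , fe' , e'∉ = outside-extension rs'
    in List.∷ʳ-injectiveˡ v v' (outside-unique (length-∷ʳ v e ℓ , fe) (length-∷ʳ v' e' ℓ' , fe') e∉ e'∉)

  rightSpecial-exists : ∃[ v ] length v ≡ n × RightSpecial x v
  rightSpecial-exists =
    let e , (ℓ , fe) , e∉ = some-outside
        i , eq = isFactor⇒factor x fe
        v = factor x i n
        e≡vc : v ++ [ x (i + n) ] ≡ e
        e≡vc = trans (sym (factor-∷ʳ x i n)) (trans (cong (factor x i) (sym ℓ)) eq)
        c , c∈ = ∈-extendAll⁺ L-factors (L-complete v (length-factor x i n) (factor-isFactor x i n))
    in v , length-factor x i n , x (i + n) , c ,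
       (λ c'≡c → e∉ (subst (_∈ chosen) e≡vc (subst (λ d → v ++ [ d ] ∈ chosen) (sym c'≡c) c∈))) ,
       subst (IsFactor x) (sym e≡vc) fe , proj₂ (All.lookup (extendAll-factors L-factors) c∈)

  extensions-≤2 : ∀ {v a b c} → length v ≡ n → a ≢ b →
                  IsFactor x (v ++ [ a ]) → IsFactor x (v ++ [ b ]) → IsFactor x (v ++ [ c ]) → c ≡ a ⊎ c ≡ b
  extensions-≤2 {v} {a} {b} {c} ℓ a≢b fa fb fc with c Fin.≟ a | c Fin.≟ b
  ... | yes c≡a | _       = inj₁ c≡a
  ... | no _    | yes c≡b = inj₂ c≡b
  ... | no c≢a  | no c≢b  = ⊥-elim (three-letters ((v ++ [ a ]) ∈? chosen) ((v ++ [ b ]) ∈? chosen))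
    where
    inside⇒outside : ∀ {d e} → d ≢ e → v ++ [ d ] ∈ chosen → v ++ [ e ] ∉ chosen
    inside⇒outside d≢e d∈ e∈ = d≢e (chosen-functional d∈ e∈)
    three-letters : Dec (v ++ [ a ] ∈ chosen) → Dec (v ++ [ b ] ∈ chosen) → ⊥
    three-letters (yes a∈) _ = c≢b (sym (outside-letters-equal ℓ fb fc
      (inside⇒outside a≢b a∈) (inside⇒outside (λ a≡c → c≢a (sym a≡c)) a∈)))
    three-letters (no a∉) (yes b∈) = c≢a (sym (outside-letters-equal ℓ fa fc a∉
      (inside⇒outside (λ b≡c → c≢b (sym b≡c)) b∈)))
    three-letters (no a∉) (no b∉) = a≢b (outside-letters-equal ℓ fa fb a∉ b∉)

module UniqueRightSpecial {k : ℕ} (y : InfWord k) (n : ℕ) ⦃ _ : NonZero n ⦄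
  (recurrent : MRecurrent (suc n) y)
  (w : Word k) (length-w : length w ≡ n)
  (c₁ c₂ : Fin k) (c₁≢c₂ : c₁ ≢ c₂)
  (t₁ : ℕ) (t₁-w : factor y t₁ n ≡ w) (t₁-c₁ : y (t₁ + n) ≡ c₁)
  (t₂ : ℕ) (t₂-w : factor y t₂ n ≡ w) (t₂-c₂ : y (t₂ + n) ≡ c₂)
  (rightSpecial-unique : ∀ v → length v ≡ n → RightSpecial y v → v ≡ w)
  (w-extensions : ∀ c → IsFactor y (w ++ [ c ]) → c ≡ c₁ ⊎ c ≡ c₂)
  where

  vertex : ℕ → Word k
  vertex i = factor y i n

  orbit : ℕ → ℕ → Word k
  orbit a r = vertex (a + r)

  orbit-+ : ∀ a q r → orbit (a + q) r ≡ orbit a (q + r)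
  orbit-+ a q r = cong vertex (+-assoc a q r)

  orbit-0 : ∀ a → orbit a 0 ≡ vertex a
  orbit-0 a = cong vertex (+-identityʳ a)

  orbit-suc : ∀ a r → orbit a (suc r) ≡ vertex (suc (a + r))
  orbit-suc a r = cong vertex (+-suc a r)

  next-letter-determined : ∀ {i i'} → vertex i ≡ vertex i' → vertex i ≢ w → y (i + n) ≡ y (i' + n)
  next-letter-determined {i} {i'} eq ≢w with y (i + n) Fin.≟ y (i' + n)
  ... | yes same   = same
  ... | no  differ = ⊥-elim (≢w (rightSpecial-unique (vertex i) (length-factor y i n)
          (y (i + n) , y (i' + n) , differ , factor-∷ʳ-isFactor y i n ,
           subst (λ v → IsFactor y (v ++ [ y (i' + n) ])) (sym eq) (factor-∷ʳ-isFactor y i' n))))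

  successor-determined : ∀ {i i'} → vertex i ≡ vertex i' → vertex i ≢ w → vertex (suc i) ≡ vertex (suc i')
  successor-determined eq ≢w = factor-step y eq (next-letter-determined eq ≢w)

  recurs : ∀ i M → ∃[ i' ] M ≤ i' × vertex i' ≡ vertex i × y (i' + n) ≡ y (i + n)
  recurs i M =
    let i' , M≤i' , eq = recurrent (factor y i (suc n)) (length-factor y i (suc n)) (factor-isFactor y i (suc n)) M
    in i' , M≤i' , factor-∷ʳ-injective y (trans (sym (factorAt≡factor y i' (suc n)))
                     (trans (cong (factorAt y i') (sym (length-factor y i (suc n)))) eq))

  orbits-agree : ∀ {a b} L → vertex a ≡ vertex b → (∀ r → r < L → orbit a r ≢ w) →
                 ∀ r → r ≤ L → orbit a r ≡ orbit b r
  orbits-agree {a} {b} L eq avoid zero    _   = trans (orbit-0 a) (trans eq (sym (orbit-0 b)))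
  orbits-agree {a} {b} L eq avoid (suc r) r<L =
    let agree = orbits-agree L eq avoid r (<⇒≤ r<L)
    in trans (orbit-suc a r) (trans (successor-determined agree (avoid r r<L)) (sym (orbit-suc b r)))

  edge-at : ∀ i → Edge y n (vertex i) (vertex (suc i))
  edge-at i = length-factor y i n , length-factor y (suc i) n , y (i + n) , y i ,
              sym (factor-∷ʳ y i n) , factor-∷ʳ-isFactor y i n

  orbit-edge : ∀ a r → Edge y n (orbit a r) (orbit a (suc r))
  orbit-edge a r = subst (Edge y n (orbit a r)) (sym (orbit-suc a r)) (edge-at (a + r))

  edge⇒position : ∀ {u v} → Edge y n u v → ∃[ i ] u ≡ vertex i × v ≡ vertex (suc i)
  edge⇒position (refl , _ , c , d , eq , uc) =
    let i , u≡ , c≡ = isFactor-∷ʳ⇒factor y refl uc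
    in i , sym u≡ , sym (List.∷-injectiveʳ (trans (factor-∷ʳ y i n) (trans (cong₂ (λ v e → v ++ [ e ]) u≡ c≡) eq)))

  vertex⇒position : ∀ {v} → Vertex y n v → ∃[ i ] v ≡ vertex i
  vertex⇒position (refl , fv) = let i , eq = isFactor⇒factor y fv in i , sym eq

  edge-off-w : ∀ {i v} → vertex i ≢ w → Edge y n (vertex i) v → v ≡ vertex (suc i)
  edge-off-w ≢w e =
    let j , eqⱼ , v≡ = edge⇒position e
    in trans v≡ (sym (successor-determined eqⱼ ≢w))

  orbit-next : ∀ a {r v} → orbit a r ≢ w → Edge y n (orbit a r) v → v ≡ orbit a (suc r)
  orbit-next a ≢w e = trans (edge-off-w ≢w e) (sym (orbit-suc a _))

  vertex-suc : ∀ a → vertex (suc a) ≡ orbit a 1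
  vertex-suc a = cong vertex (+-comm 1 a)

  module FirstReturn (t : ℕ) (t-w : vertex t ≡ w) where

    opaque
      returns : ∃[ m ] orbit t (suc m) ≡ w × (∀ r → r < m → orbit t (suc r) ≢ w)
      returns =
        let i , t<i , i-t , _ = recurs t (suc t)
            z , i≡ = ∸-split t<i
            m , _ , hit , below = least (λ r → orbit t (suc r) ≟ʷ w) z
                                    (trans (cong vertex (trans (+-suc t z) (sym i≡))) (trans i-t t-w))
        in m , hit , below

    m : ℕ
    m = proj₁ returns

    ℓ : ℕ
    ℓ = suc m

    ℓ-w : orbit t ℓ ≡ w
    ℓ-w = proj₁ (proj₂ returns)

    0-w : orbit t 0 ≡ w
    0-w = trans (orbit-0 t) t-w

    avoids-w : ∀ {q} → 0 < q → q < ℓ → orbit t q ≢ w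
    avoids-w {suc r} _ (s≤s r<m) = proj₂ (proj₂ returns) r r<m

    no-repeat : ∀ {q q'} → 0 < q → q < q' → q' ≤ ℓ → orbit t q ≢ orbit t q'
    no-repeat {q} {q'} 0<q q<q' q'≤ℓ eq = avoids-w 0<q+L q+L<ℓ (begin
      orbit t (q + L)    ≡⟨ orbit-+ t q L ⟨
      orbit (t + q) L    ≡⟨ orbits-agree L (sym eq) avoid L ≤-refl ⟨
      orbit (t + q') L   ≡⟨ orbit-+ t q' L ⟩
      orbit t (q' + L)   ≡⟨ cong (orbit t) ℓ≡ ⟨
      orbit t ℓ          ≡⟨ ℓ-w ⟩
      w                  ∎)
      where
      open ≡-Reasoning
      L = proj₁ (∸-split q'≤ℓ)
      ℓ≡ = proj₂ (∸-split q'≤ℓ)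
      0<q+L = ≤-trans 0<q (m≤m+n q L)
      q+L<ℓ = subst (q + L <_) (sym ℓ≡) (+-monoˡ-< L q<q')
      avoid : ∀ r → r < L → orbit (t + q') r ≢ w
      avoid r r<L eq' = avoids-w (≤-trans (≤-trans 0<q (<⇒≤ q<q')) (m≤m+n q' r))
        (subst (q' + r <_) (sym ℓ≡) (+-monoʳ-< q' r<L)) (trans (sym (orbit-+ t q' r)) eq')

    orbit-injective : ∀ {q q'} → 0 < q → 0 < q' → q ≤ ℓ → q' ≤ ℓ → orbit t q ≡ orbit t q' → q ≡ q'
    orbit-injective {q} {q'} 0<q 0<q' q≤ℓ q'≤ℓ eq with <-cmp q q'
    ... | tri< q<q' _ _ = ⊥-elim (no-repeat 0<q q<q' q'≤ℓ eq)
    ... | tri≈ _ q≡q' _ = q≡q'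
    ... | tri> _ _ q'<q = ⊥-elim (no-repeat 0<q' q'<q q≤ℓ (sym eq))

    orbit-injective₀ : ∀ {q q'} → q < ℓ → q' < ℓ → orbit t q ≡ orbit t q' → q ≡ q'
    orbit-injective₀ {zero}  {zero}   _   _    _  = refl
    orbit-injective₀ {zero}  {suc r'} _   r'<ℓ eq = ⊥-elim (avoids-w z<s r'<ℓ (trans (sym eq) 0-w))
    orbit-injective₀ {suc r} {zero}   r<ℓ _    eq = ⊥-elim (avoids-w z<s r<ℓ (trans eq 0-w))
    orbit-injective₀ {suc r} {suc r'} r<ℓ r'<ℓ eq = orbit-injective z<s z<s (<⇒≤ r<ℓ) (<⇒≤ r'<ℓ) eq

    follows : ∀ {a} → vertex a ≡ w → y (a + n) ≡ y (t + n) → ∀ q → q ≤ ℓ → orbit a q ≡ orbit t q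
    follows {a} a-w same zero    _       = trans (orbit-0 a) (trans a-w (sym 0-w))
    follows {a} a-w same (suc r) (s≤s r≤m) = begin
      orbit a (suc r)      ≡⟨ orbit-suc a r ⟩
      orbit (suc a) r      ≡⟨ orbits-agree m (sym first) avoid r r≤m ⟨
      orbit (suc t) r      ≡⟨ orbit-suc t r ⟨
      orbit t (suc r)      ∎
      where
      open ≡-Reasoning
      first : vertex (suc a) ≡ vertex (suc t)
      first = factor-step y (trans a-w (sym t-w)) same
      avoid : ∀ r → r < m → orbit (suc t) r ≢ w
      avoid r r<m eq = avoids-w z<s (s≤s r<m) (trans (orbit-suc t r) eq)

    successor-injective : ∀ {q q'} → q < ℓ → q' < ℓ → orbit t (suc q) ≡ orbit t (suc q') → q ≡ q'
    successor-injective q<ℓ q'<ℓ eq = suc-injective (orbit-injective z<s z<s q<ℓ q'<ℓ eq)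

    inner : List (Word k)
    inner = applyUpTo (orbit t ∘ suc) m

    loop : List (Word k)
    loop = w ∷ inner ++ [ w ]

    loop≡ : loop ≡ applyUpTo (orbit t) (suc ℓ)
    loop≡ = cong₂ _∷_ (sym 0-w) (trans (cong (λ v → inner ++ [ v ]) (sym ℓ-w)) (List.applyUpTo-∷ʳ (orbit t ∘ suc) m))

    w∉inner : w ∉ inner
    w∉inner w∈ = let r , r<m , w≡ = ∈-applyUpTo⁻ (orbit t ∘ suc) w∈ in avoids-w z<s (s≤s r<m) (sym w≡)

    loop-cycle : Cycle y n w loop
    loop-cycle = walk-subst 0-w ℓ-w (sym loop≡) (applyUpTo-walk (orbit t) (orbit-edge t) ℓ) ,
                 inner , refl , w∉inner ,
                 applyUpTo⁺₁ (orbit t ∘ suc) m (λ i<j j<m → no-repeat z<s (s≤s i<j) (<⇒≤ (s≤s j<m)))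

    cycle-unique : ∀ inner' {v Q} → Walk y n v w Q → v ≡ orbit t 1 → Q ≡ inner' ++ [ w ] → w ∉ inner' →
                   w ∷ Q ≡ loop
    cycle-unique inner' W v≡ Q≡ w∉
      with inner'≡ , end ← walk-follows (orbit t ∘ suc) (orbit-next t) inner' W v≡ Q≡ w∉
      with <-cmp (length inner') m
    ... | tri< len<m _ _ = ⊥-elim (avoids-w z<s (s≤s len<m) end)
    ... | tri> _ _ m<len = ⊥-elim (w∉ (subst (_∈ inner') ℓ-w (subst (orbit t ℓ ∈_) (sym inner'≡)
                                      (∈-applyUpTo⁺ (orbit t ∘ suc) m<len))))
    ... | tri≈ _ len≡m _ = cong (w ∷_) (trans Q≡ (cong (_++ [ w ]) (trans inner'≡ (cong (applyUpTo (orbit t ∘ suc)) len≡m))))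

    remaining : ∀ {r e} → 0 < r → ℓ ≡ r + e → (∀ z → z < e → orbit (t + r) z ≢ w) × orbit (t + r) e ≡ w
    remaining {r} {e} 0<r ℓ≡ =
      (λ z z<e eq → avoids-w (≤-trans 0<r (m≤m+n r z)) (subst (r + z <_) (sym ℓ≡) (+-monoʳ-< r z<e))
                              (trans (sym (orbit-+ t r z)) eq)) ,
      trans (orbit-+ t r e) (trans (cong (orbit t) (sym ℓ≡)) ℓ-w)

    tracks : ∀ {a} → vertex a ≡ w → y (a + n) ≡ y (t + n) → ∀ r →
             (r < ℓ × vertex (a + r) ≡ orbit t r × vertex (suc (a + r)) ≡ orbit t (suc r))
             ⊎ (∃[ z ] r ≡ ℓ + z × orbit a ℓ ≡ w)
    tracks a-w same r with r <? ℓ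
    ... | yes r<ℓ = inj₁ (r<ℓ , follows a-w same r (<⇒≤ r<ℓ) ,
                          trans (sym (orbit-suc _ r)) (follows a-w same (suc r) r<ℓ))
    ... | no  r≮ℓ = let z , r≡ = ∸-split (≮⇒≥ r≮ℓ) in inj₂ (z , r≡ , trans (follows a-w same ℓ ≤-refl) ℓ-w)

  w-branch : ∀ {i} → vertex i ≡ w → y (i + n) ≡ y (t₁ + n) ⊎ y (i + n) ≡ y (t₂ + n)
  w-branch {i} i-w = Sum.map (λ c → trans c (sym t₁-c₁)) (λ c → trans c (sym t₂-c₂))
    (w-extensions (y (i + n)) (subst (λ v → IsFactor y (v ++ [ y (i + n) ])) i-w (factor-∷ʳ-isFactor y i n)))

  first-hits-agree : ∀ {a b e e'} → vertex a ≡ vertex b →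
                     (∀ r → r < e → orbit a r ≢ w) → orbit a e ≡ w →
                     (∀ r → r < e' → orbit b r ≢ w) → orbit b e' ≡ w → e ≡ e'
  first-hits-agree {e = e} {e'} eq avoid hit avoid' hit' with <-cmp e e'
  ... | tri< e<e' _ _ = ⊥-elim (avoid' e e<e' (trans (sym (orbits-agree e eq avoid e ≤-refl)) hit))
  ... | tri≈ _ e≡e' _ = e≡e'
  ... | tri> _ _ e'<e = ⊥-elim (avoid e' e'<e (trans (sym (orbits-agree e' (sym eq) avoid' e' ≤-refl)) hit'))

  module L₁ = FirstReturn t₁ t₁-w
  module L₂ = FirstReturn t₂ t₂-w

  second-vertices-differ : orbit t₁ 1 ≢ orbit t₂ 1
  second-vertices-differ eq = c₁≢c₂ (trans (sym t₁-c₁) (trans (factor-last y n eq') t₂-c₂))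
    where eq' = trans (vertex-suc t₁) (trans eq (sym (vertex-suc t₂)))

  loops-differ : L₁.loop ≢ L₂.loop
  loops-differ eq = second-vertices-differ
    (List.∷-injectiveˡ (List.∷-injectiveʳ (trans (sym L₁.loop≡) (trans eq L₂.loop≡))))

  cycles-classified : ∀ P → Cycle y n w P → P ≡ L₁.loop ⊎ P ≡ L₂.loop
  cycles-classified P (W , inner , P≡ , w∉ , _) = classify W P≡
    where
    classify : ∀ {P} → Walk y n w w P → P ≡ w ∷ inner ++ [ w ] → P ≡ L₁.loop ⊎ P ≡ L₂.loop
    classify (here _)   eq with () ← List.++-conicalʳ inner _ (sym (List.∷-injectiveʳ eq))
    classify (step e W) eq with i , w≡ , v≡ ← edge⇒position e with w-branch (sym w≡)
    ... | inj₁ same = inj₁ (L₁.cycle-unique inner W (trans v≡ (trans (vertex-suc i) (L₁.follows (sym w≡) same 1 (s≤s z≤n))))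
                              (List.∷-injectiveʳ eq) w∉)
    ... | inj₂ same = inj₂ (L₂.cycle-unique inner W (trans v≡ (trans (vertex-suc i) (L₂.follows (sym w≡) same 1 (s≤s z≤n))))
                              (List.∷-injectiveʳ eq) w∉)

  EdgeOn : ℕ → ℕ → ℕ → Set
  EdgeOn a L i = ∃[ q ] q < L × vertex i ≡ orbit a q × vertex (suc i) ≡ orbit a (suc q)

  EdgeOnLoops : ℕ → Set
  EdgeOnLoops i = EdgeOn t₁ L₁.ℓ i ⊎ EdgeOn t₂ L₂.ℓ i

  edgeOn-transport : ∀ {a L i i'} → vertex i ≡ vertex i' → vertex (suc i) ≡ vertex (suc i') → EdgeOn a L i' → EdgeOn a L i
  edgeOn-transport eq eq' (q , q<L , src , tgt) = q , q<L , trans eq src , trans eq' tgt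

  edgeOnLoops-from-w : ∀ r {a} → vertex a ≡ w → EdgeOnLoops (a + r)
  edgeOnLoops-from-w = <-rec _ λ r rec {a} a-w → case w-branch a-w of λ where
      (inj₁ same) → continue rec L₁.m (L₁.tracks a-w same r) inj₁
      (inj₂ same) → continue rec L₂.m (L₂.tracks a-w same r) inj₂
    where
    continue : ∀ {r a t} → (∀ {z} → z < r → ∀ {a} → vertex a ≡ w → EdgeOnLoops (a + z)) → ∀ m →
               (r < suc m × vertex (a + r) ≡ orbit t r × vertex (suc (a + r)) ≡ orbit t (suc r))
               ⊎ (∃[ z ] r ≡ suc m + z × orbit a (suc m) ≡ w) →
               (EdgeOn t (suc m) (a + r) → EdgeOnLoops (a + r)) → EdgeOnLoops (a + r)
    continue {r} rec m (inj₁ (r<ℓ , src , tgt)) into = into (r , r<ℓ , src , tgt)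
    continue {r} {a} rec m (inj₂ (z , r≡ , hit)) _ =
      subst EdgeOnLoops (trans (+-assoc a (suc m) z) (cong (a +_) (sym r≡)))
            (rec (subst (z <_) (sym r≡) (s≤s (m≤n+m z m))) hit)

  edgeOnLoops : ∀ i → EdgeOnLoops i
  edgeOnLoops i with i' , t₁≤i' , eq , same ← recurs i t₁ with z , i'≡ ← ∸-split t₁≤i' =
    Sum.map (edgeOn-transport (sym eq) (sym next)) (edgeOn-transport (sym eq) (sym next))
      (subst EdgeOnLoops (sym i'≡) (edgeOnLoops-from-w z t₁-w))
    where next = factor-step y eq same

  -- u, the first vertex of the a-cycle lying on the b-cycle, is where the two cycles merge.
  Meets : ℕ → Set
  Meets s = ∃[ r ] r ≤ L₂.m × orbit t₁ (suc s) ≡ orbit t₂ (suc r)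

  opaque
    first-meeting : ∃[ s ] s ≤ L₁.m × Meets s × (∀ s' → s' < s → ¬ Meets s')
    first-meeting = least (λ s → ∃≤? (λ r → orbit t₁ (suc s) ≟ʷ orbit t₂ (suc r)) L₂.m) L₁.m
                          (L₂.m , ≤-refl , trans L₁.ℓ-w (sym L₂.ℓ-w))

  s₁ s₂ r₁ r₂ : ℕ
  s₁ = proj₁ first-meeting
  s₂ = proj₁ (proj₁ (proj₂ (proj₂ first-meeting)))
  r₁ = suc s₁
  r₂ = suc s₂

  s₁≤m₁ : s₁ ≤ L₁.m
  s₁≤m₁ = proj₁ (proj₂ first-meeting)

  s₂≤m₂ : s₂ ≤ L₂.m
  s₂≤m₂ = proj₁ (proj₂ (proj₁ (proj₂ (proj₂ first-meeting))))

  meet : orbit t₁ r₁ ≡ orbit t₂ r₂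
  meet = proj₂ (proj₂ (proj₁ (proj₂ (proj₂ first-meeting))))

  no-earlier-meeting : ∀ s → s < s₁ → ¬ Meets s
  no-earlier-meeting = proj₂ (proj₂ (proj₂ first-meeting))

  u : Word k
  u = orbit t₁ r₁

  p : ℕ
  p = t₁ + r₁

  -- The length of the common path from u back to w: the d of case (b).
  e : ℕ
  e = proj₁ (∸-split s₁≤m₁)

  ℓ₁≡ : L₁.ℓ ≡ r₁ + e
  ℓ₁≡ = cong suc (proj₂ (∸-split s₁≤m₁))

  u-to-w-avoids-w : ∀ z → z < e → orbit p z ≢ w
  u-to-w-avoids-w = proj₁ (L₁.remaining z<s ℓ₁≡)

  u-to-w : orbit p e ≡ w
  u-to-w = proj₂ (L₁.remaining z<s ℓ₁≡)

  ℓ₂≡ : L₂.ℓ ≡ r₂ + e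
  ℓ₂≡ = let _ , m₂≡ = ∸-split s₂≤m₂
            avoid₂ , hit₂ = L₂.remaining z<s (cong suc m₂≡)
        in trans (cong suc m₂≡) (cong (r₂ +_) (first-hits-agree (sym meet) avoid₂ hit₂ u-to-w-avoids-w u-to-w))

  common-tail : ∀ z → z ≤ e → orbit t₁ (r₁ + z) ≡ orbit t₂ (r₂ + z)
  common-tail z z≤e = begin
    orbit t₁ (r₁ + z)    ≡⟨ orbit-+ t₁ r₁ z ⟨
    orbit p z            ≡⟨ orbits-agree e meet u-to-w-avoids-w z z≤e ⟩
    orbit (t₂ + r₂) z    ≡⟨ orbit-+ t₂ r₂ z ⟩
    orbit t₂ (r₂ + z)    ∎
    where open ≡-Reasoning

  u-to-w-avoids-u : ∀ z → 0 < z → z ≤ e → orbit p z ≢ u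
  u-to-w-avoids-u z 0<z z≤e eq = <⇒≢ 0<z (sym (+-cancelˡ-≡ r₁ z 0 (trans r₁+z≡r₁ (sym (+-identityʳ r₁)))))
    where
    r₁+z≡r₁ = L₁.orbit-injective z<s z<s (subst (r₁ + z ≤_) (sym ℓ₁≡) (+-monoʳ-≤ r₁ z≤e)) (s≤s s₁≤m₁)
                (trans (sym (orbit-+ t₁ r₁ z)) eq)

  predecessors-differ : y (t₁ + s₁) ≢ y (t₂ + s₂)
  predecessors-differ same = differ s₁≤m₁ s₂≤m₂ meet no-earlier-meeting
    (factor-stepBack y same (trans (sym (cong vertex (+-suc t₁ s₁))) (trans meet (cong vertex (+-suc t₂ s₂)))))
    where
    differ : ∀ {a b} → a ≤ L₁.m → b ≤ L₂.m → orbit t₁ (suc a) ≡ orbit t₂ (suc b) →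
             (∀ s → s < a → ¬ Meets s) → orbit t₁ a ≢ orbit t₂ b
    differ {zero}  {zero}  _   _   meet' _ _ = second-vertices-differ meet'
    differ {zero}  {suc b} _   b<ℓ _   _ eq = L₂.avoids-w z<s (s≤s b<ℓ) (trans (sym eq) L₁.0-w)
    differ {suc a} {zero}  a<ℓ _   _   _ eq = L₁.avoids-w z<s (s≤s a<ℓ) (trans eq L₂.0-w)
    differ {suc a} {suc b} _   b<ℓ _ earlier eq = earlier a ≤-refl (b , <⇒≤ b<ℓ , eq)

  u-leftSpecial : LeftSpecial y u
  u-leftSpecial = y (t₁ + s₁) , y (t₂ + s₂) , predecessors-differ ,
    subst (λ v → IsFactor y (y (t₁ + s₁) ∷ v)) (cong vertex (sym (+-suc t₁ s₁))) (factor-isFactor y (t₁ + s₁) (suc n)) ,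
    subst (λ v → IsFactor y (y (t₂ + s₂) ∷ v)) (trans (cong vertex (sym (+-suc t₂ s₂))) (sym meet))
          (factor-isFactor y (t₂ + s₂) (suc n))

  loops-cross : ∀ {q q'} → q < L₁.ℓ → q' < L₂.ℓ → orbit t₁ (suc q) ≡ orbit t₂ (suc q') →
                orbit t₁ (suc q) ≡ u ⊎ orbit t₁ q ≡ orbit t₂ q'
  loops-cross {q} {q'} q<ℓ q'<ℓ eq with <-cmp q s₁
  ... | tri< q<s₁ _ _ = ⊥-elim (no-earlier-meeting q q<s₁ (q' , ≤-pred q'<ℓ , eq))
  ... | tri≈ _ q≡s₁ _ = inj₁ (cong (orbit t₁ ∘ suc) q≡s₁)
  ... | tri> _ _ s₁<q with z , q≡ ← ∸-split s₁<q = inj₂ (begin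
    orbit t₁ q           ≡⟨ cong (orbit t₁) q≡ ⟩
    orbit t₁ (r₁ + z)    ≡⟨ common-tail z (<⇒≤ z<e) ⟩
    orbit t₂ (r₂ + z)    ≡⟨ cong (orbit t₂) q'≡ ⟨
    orbit t₂ q'          ∎)
    where
    open ≡-Reasoning
    z<e : z < e
    z<e = +-cancelˡ-< r₁ z e (subst₂ _<_ q≡ ℓ₁≡ q<ℓ)
    q'≡ : q' ≡ r₂ + z
    q'≡ = suc-injective (trans
      (L₂.orbit-injective z<s z<s q'<ℓ (subst (r₂ + suc z ≤_) (sym ℓ₂≡) (+-monoʳ-≤ r₂ z<e))
         (trans (sym eq) (trans (cong (orbit t₁) (trans (cong suc q≡) (sym (+-suc r₁ z)))) (common-tail (suc z) z<e))))
      (+-suc r₂ z))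

  leftSpecial-unique : ∀ v → length v ≡ n → LeftSpecial y v → v ≡ u
  leftSpecial-unique v ℓv (c , d , c≢d , fc , fd)
    with i , yi , vi ← isFactor-∷⇒factor y ℓv fc | i' , yi' , vi' ← isFactor-∷⇒factor y ℓv fd =
    compare (edgeOnLoops i) (edgeOnLoops i')
    where
    predecessors : vertex i ≢ vertex i'
    predecessors eq = c≢d (trans (sym yi) (trans (factor-head y n eq) yi'))
    successors : vertex (suc i) ≡ vertex (suc i')
    successors = trans vi (sym vi')
    same-loop : ∀ {a L} → (∀ {q q'} → q < L → q' < L → orbit a (suc q) ≡ orbit a (suc q') → q ≡ q') →
                EdgeOn a L i → EdgeOn a L i' → v ≡ u
    same-loop inj (q , q<L , src , tgt) (q' , q'<L , src' , tgt') =
      ⊥-elim (predecessors (trans src (trans (cong (orbit _) (inj q<L q'<L (trans (sym tgt) (trans successors tgt')))) (sym src'))))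
    compare : EdgeOnLoops i → EdgeOnLoops i' → v ≡ u
    compare (inj₁ on) (inj₁ on') = same-loop L₁.successor-injective on on'
    compare (inj₂ on) (inj₂ on') = same-loop L₂.successor-injective on on'
    compare (inj₁ (q , q<ℓ , src , tgt)) (inj₂ (q' , q'<ℓ , src' , tgt'))
      with loops-cross q<ℓ q'<ℓ (trans (sym tgt) (trans successors tgt'))
    ... | inj₁ at-u = trans (sym vi) (trans tgt at-u)
    ... | inj₂ eq   = ⊥-elim (predecessors (trans src (trans eq (sym src'))))
    compare (inj₂ (q , q<ℓ , src , tgt)) (inj₁ (q' , q'<ℓ , src' , tgt'))
      with loops-cross q'<ℓ q<ℓ (trans (sym tgt') (trans (sym successors) tgt))
    ... | inj₁ at-u = trans (sym vi') (trans tgt' at-u)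
    ... | inj₂ eq   = ⊥-elim (predecessors (trans src (trans (sym eq) (sym src'))))

  w-rightSpecial : RightSpecial y w
  w-rightSpecial = c₁ , c₂ , c₁≢c₂ ,
    subst₂ (λ v c → IsFactor y (v ++ [ c ])) t₁-w t₁-c₁ (factor-∷ʳ-isFactor y t₁ n) ,
    subst₂ (λ v c → IsFactor y (v ++ [ c ])) t₂-w t₂-c₂ (factor-∷ʳ-isFactor y t₂ n)

  formA : e ≡ 0 → FormA y n
  formA e≡0 = w , (length-w , inj₂ w-rightSpecial , special-unique ,
                   L₁.loop , L₂.loop , loops-differ , L₁.loop-cycle , L₂.loop-cycle , cycles-classified) ,
              subst (LeftSpecial y) u≡w u-leftSpecial , w-rightSpecial
    where
    u≡w : u ≡ w
    u≡w = trans (sym (orbit-0 p)) (subst (λ z → orbit p z ≡ w) e≡0 u-to-w)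
    special-unique : ∀ v → length v ≡ n → Special y v → v ≡ w
    special-unique v ℓv (inj₁ ls) = trans (leftSpecial-unique v ℓv ls) u≡w
    special-unique v ℓv (inj₂ rs) = rightSpecial-unique v ℓv rs

  u≢w : 0 < e → u ≢ w
  u≢w 0<e eq = u-to-w-avoids-w 0 0<e (trans (orbit-0 p) eq)

  edgeOn-split : ∀ {a r L i} → EdgeOn a (r + L) i → EdgeOn a r i ⊎ EdgeOn (a + r) L i
  edgeOn-split {a} {r} {L} (q , q<r+L , src , tgt) with q <? r
  ... | yes q<r = inj₁ (q , q<r , src , tgt)
  ... | no  q≮r with z , q≡ ← ∸-split (≮⇒≥ q≮r) =
    inj₂ (z , +-cancelˡ-< r z L (subst (_< r + L) q≡ q<r+L) ,
          trans src (trans (cong (orbit a) q≡) (sym (orbit-+ a r z))) ,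
          trans tgt (trans (cong (orbit a) (trans (cong suc q≡) (sym (+-suc r z)))) (sym (orbit-+ a r (suc z)))))

  edgeOn-resp : ∀ {a b L i} → (∀ z → z ≤ L → orbit a z ≡ orbit b z) → EdgeOn b L i → EdgeOn a L i
  edgeOn-resp agree (q , q<L , src , tgt) = q , q<L , trans src (sym (agree q (<⇒≤ q<L))) , trans tgt (sym (agree (suc q) q<L))

  edgeOn⇒∈ : ∀ {a L i} → EdgeOn a L i → vertex i ∈ applyUpTo (orbit a) (suc L)
  edgeOn⇒∈ {a} (q , q<L , src , _) = subst (_∈ _) (sym src) (∈-applyUpTo⁺ (orbit a) (<⇒≤ (s≤s q<L)))

  edgeOn⇒consecutive : ∀ {a L i} → EdgeOn a L i → Consecutive (vertex i) (vertex (suc i)) (applyUpTo (orbit a) (suc L))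
  edgeOn⇒consecutive {a} (q , q<L , src , tgt) =
    subst₂ (λ v v' → Consecutive v v' _) (sym src) (sym tgt) (applyUpTo-consecutive (orbit a) q<L)

  P₁ P₂ Q : List (Word k)
  P₁ = applyUpTo (orbit t₁) (suc r₁)
  P₂ = applyUpTo (orbit t₂) (suc r₂)
  Q  = applyUpTo (orbit p) (suc e)

  edge-on-paths : ∀ i → EdgeOn t₁ r₁ i ⊎ EdgeOn t₂ r₂ i ⊎ EdgeOn p e i
  edge-on-paths i with edgeOnLoops i
  ... | inj₁ on = Sum.map₂ inj₂ (edgeOn-split (subst (λ L → EdgeOn t₁ L i) ℓ₁≡ on))
  ... | inj₂ on = inj₂ (Sum.map₂ (edgeOn-resp (orbits-agree e meet u-to-w-avoids-w))
                                  (edgeOn-split (subst (λ L → EdgeOn t₂ L i) ℓ₂≡ on)))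

  module _ (0<e : 0 < e) where

    r₁<ℓ₁ : r₁ < L₁.ℓ
    r₁<ℓ₁ = subst (r₁ <_) (sym ℓ₁≡) (m<m+n r₁ 0<e)

    r₂<ℓ₂ : r₂ < L₂.ℓ
    r₂<ℓ₂ = subst (r₂ <_) (sym ℓ₂≡) (m<m+n r₂ 0<e)

    path₁ : Path y n w u P₁
    path₁ = walk-subst L₁.0-w refl refl (applyUpTo-walk (orbit t₁) (orbit-edge t₁) r₁) ,
            applyUpTo⁺₁ (orbit t₁) (suc r₁) λ i<j j<1+r →
              let j<ℓ = <-≤-trans j<1+r r₁<ℓ₁ in <⇒≢ i<j ∘ L₁.orbit-injective₀ (<-trans i<j j<ℓ) j<ℓ

    path₂ : Path y n w u P₂
    path₂ = walk-subst L₂.0-w (sym meet) refl (applyUpTo-walk (orbit t₂) (orbit-edge t₂) r₂) ,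
            applyUpTo⁺₁ (orbit t₂) (suc r₂) λ i<j j<1+r →
              let j<ℓ = <-≤-trans j<1+r r₂<ℓ₂ in <⇒≢ i<j ∘ L₂.orbit-injective₀ (<-trans i<j j<ℓ) j<ℓ

    path-back : Path y n u w Q
    path-back = walk-subst (orbit-0 p) u-to-w refl (applyUpTo-walk (orbit p) (orbit-edge p) e) ,
                applyUpTo⁺₁ (orbit p) (suc e) λ {i} {j} i<j j<1+e eq →
                  <⇒≢ i<j (+-cancelˡ-≡ r₁ i j (L₁.orbit-injective z<s z<s (bound i (<⇒≤ (<-≤-trans i<j (≤-pred j<1+e))))
                                                 (bound j (≤-pred j<1+e))
                                                 (trans (sym (orbit-+ t₁ r₁ i)) (trans eq (orbit-+ t₁ r₁ j)))))
      where
      bound : ∀ z → z ≤ e → r₁ + z ≤ L₁.ℓ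
      bound z z≤e = subst (r₁ + z ≤_) (sym ℓ₁≡) (+-monoʳ-≤ r₁ z≤e)

    paths-differ : P₁ ≢ P₂
    paths-differ eq = second-vertices-differ (List.∷-injectiveˡ (List.∷-injectiveʳ eq))

    paths-meet-at-ends : ∀ v → v ∈ P₁ → v ∈ P₂ → v ≡ w ⊎ v ≡ u
    paths-meet-at-ends v v∈₁ v∈₂ with ∈-applyUpTo⁻ (orbit t₁) v∈₁ | ∈-applyUpTo⁻ (orbit t₂) v∈₂
    ... | zero  , _ , v≡ | _ = inj₁ (trans v≡ L₁.0-w)
    ... | suc a , _ , v≡ | zero , _ , v≡' = inj₁ (trans v≡' L₂.0-w)
    ... | suc a , s≤s a≤s₁ , v≡ | suc b , s≤s b≤s₂ , v≡' with m≤n⇒m<n∨m≡n (≤-pred a≤s₁)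
    ...   | inj₁ a<s₁ = ⊥-elim (no-earlier-meeting a a<s₁ (b , ≤-trans (≤-pred b≤s₂) s₂≤m₂ , trans (sym v≡) v≡'))
    ...   | inj₂ a≡s₁ = inj₂ (trans v≡ (cong (orbit t₁ ∘ suc) a≡s₁))

    vertices-covered : ∀ v → Vertex y n v → v ∈ P₁ ⊎ v ∈ P₂ ⊎ v ∈ Q
    vertices-covered v vv with i , v≡ ← vertex⇒position vv =
      Sum.map (subst (_∈ P₁) (sym v≡) ∘ edgeOn⇒∈)
              (Sum.map (subst (_∈ P₂) (sym v≡) ∘ edgeOn⇒∈) (subst (_∈ Q) (sym v≡) ∘ edgeOn⇒∈))
              (edge-on-paths i)

    edges-covered : ∀ a b → Edge y n a b → Consecutive a b P₁ ⊎ Consecutive a b P₂ ⊎ Consecutive a b Q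
    edges-covered a b ab with i , a≡ , b≡ ← edge⇒position ab =
      Sum.map (cons ∘ edgeOn⇒consecutive) (Sum.map (cons ∘ edgeOn⇒consecutive) (cons ∘ edgeOn⇒consecutive))
              (edge-on-paths i)
      where
      cons : ∀ {P} → Consecutive (vertex i) (vertex (suc i)) P → Consecutive a b P
      cons = subst₂ (λ v v' → Consecutive v v' _) (sym a≡) (sym b≡)

    formB : FormB y n
    formB = u , w , length-factor y p n , length-w , u≢w 0<e , u-leftSpecial , leftSpecial-unique ,
            w-rightSpecial , rightSpecial-unique ,
            P₁ , P₂ , Q , path₁ , path₂ , paths-differ , paths-meet-at-ends , path-back ,
            vertices-covered , edges-covered

  leftSpecial-w⇒formA : (∀ v → length v ≡ n → LeftSpecial y v → v ≡ w) → FormA y n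
  leftSpecial-w⇒formA w-only with e ≟ 0
  ... | yes e≡0 = formA e≡0
  ... | no  e≢0 = ⊥-elim (u≢w (n≢0⇒n>0 e≢0) (w-only u (length-factor y p n) u-leftSpecial))

  predecessor-determined : ∀ {a b} → vertex (suc a) ≡ vertex (suc b) → vertex (suc b) ≢ u → y a ≡ y b
  predecessor-determined {a} {b} eq ≢u with y a Fin.≟ y b
  ... | yes same   = same
  ... | no  differ = ⊥-elim (≢u (leftSpecial-unique (vertex (suc b)) (length-factor y (suc b) n)
          (y a , y b , differ , subst (λ v → IsFactor y (y a ∷ v)) eq (factor-isFactor y a (suc n)) ,
           factor-isFactor y b (suc n))))

  backwards-agree : ∀ L {a b} → orbit a L ≡ orbit b L → (∀ z → 0 < z → z ≤ L → orbit b z ≢ u) → vertex a ≡ vertex b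
  backwards-agree zero    {a} {b} eq _     = trans (sym (orbit-0 a)) (trans eq (orbit-0 b))
  backwards-agree (suc L) {a} {b} eq avoid = factor-stepBack y (predecessor-determined next second≢u) next
    where
    next : vertex (suc a) ≡ vertex (suc b)
    next = backwards-agree L (trans (sym (orbit-suc a L)) (trans eq (orbit-suc b L)))
             λ z 0<z z≤L → avoid (suc z) z<s (s≤s z≤L) ∘ trans (orbit-suc b z)
    second≢u : vertex (suc b) ≢ u
    second≢u = avoid 1 z<s (s≤s z≤n) ∘ trans (sym (vertex-suc b))

  from-u : ∀ {q} → vertex q ≡ u → ∀ z → z ≤ e → orbit q z ≡ orbit p z
  from-u q-u z z≤e = sym (orbits-agree e (sym q-u) u-to-w-avoids-w z z≤e)

  to-w : ∀ {q} → orbit q e ≡ w → ∀ z → z ≤ e → orbit q z ≡ orbit p z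
  to-w {q} q-w z z≤e = backwards-agree d (begin
      orbit (q + z) d   ≡⟨ orbit-+ q z d ⟩
      orbit q (z + d)   ≡⟨ cong (orbit q) e≡ ⟨
      orbit q e         ≡⟨ trans q-w (sym u-to-w) ⟩
      orbit p e         ≡⟨ cong (orbit p) e≡ ⟩
      orbit p (z + d)   ≡⟨ orbit-+ p z d ⟨
      orbit (p + z) d   ∎)
    λ z' 0<z' z'≤d → u-to-w-avoids-u (z + z') (≤-trans 0<z' (m≤n+m z' z))
                       (subst (z + z' ≤_) (sym e≡) (+-monoʳ-≤ z z'≤d)) ∘ trans (sym (orbit-+ p z z'))
    where
    open ≡-Reasoning
    d = proj₁ (∸-split z≤e)
    e≡ = proj₂ (∸-split z≤e)

module RecurrentSuffix {k : ℕ} (x : InfWord k) (aperiodic : ¬ UltPeriodic x) (n m : ℕ) ⦃ _ : NonZero n ⦄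
  (p[n] : HasComplexity x n m) (p[1+n] : HasComplexity x (suc n) (suc m))
  (j : ℕ) (prefix : IsPrefixLength (suc n) x j) where

  open ComplexityGapOne x n m p[n] p[1+n]

  y : InfWord k
  y = shift x j

  factorAt-shift : ∀ q i L → factorAt (shift x q) i L ≡ factor x (q + i) L
  factorAt-shift q i L = trans (factorAt≡factor (shift x q) i L) (factor-shift x q i L)

  isFactor-y⇒x : ∀ {v} → IsFactor y v → IsFactor x v
  isFactor-y⇒x (i , eq) = j + i , trans (factorAt≡factor x (j + i) _) (trans (sym (factorAt-shift j i _)) eq)

  w : Word k
  w = proj₁ rightSpecial-exists

  length-w : length w ≡ n
  length-w = proj₁ (proj₂ rightSpecial-exists)

  w-rightSpecial : RightSpecial x w
  w-rightSpecial = proj₂ (proj₂ rightSpecial-exists)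

  a b : Fin k
  a = proj₁ w-rightSpecial
  b = proj₁ (proj₂ w-rightSpecial)

  a≢b : a ≢ b
  a≢b = proj₁ (proj₂ (proj₂ w-rightSpecial))

  w-a : IsFactor x (w ++ [ a ])
  w-a = proj₁ (proj₂ (proj₂ (proj₂ w-rightSpecial)))

  w-b : IsFactor x (w ++ [ b ])
  w-b = proj₂ (proj₂ (proj₂ (proj₂ w-rightSpecial)))

  w-extensions : ∀ c → IsFactor x (w ++ [ c ]) → c ≡ a ⊎ c ≡ b
  w-extensions c = extensions-≤2 length-w a≢b w-a w-b

  rightSpecial-y-unique : ∀ v → length v ≡ n → RightSpecial y v → v ≡ w
  rightSpecial-y-unique v ℓv (c , d , c≢d , fc , fd) =
    rightSpecial-unique ℓv length-w (c , d , c≢d , isFactor-y⇒x fc , isFactor-y⇒x fd) w-rightSpecial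

  y-has-rightSpecial : ¬ ¬ (∃[ v ] length v ≡ n × RightSpecial y v)
  y-has-rightSpecial none =
    let i , i' , i<i' , same = repeated-factor y n (proj₁ p[n])
          (λ i → proj₂ (proj₂ (proj₂ (proj₂ p[n]))) _ (length-factor y i n) (isFactor-y⇒x (factor-isFactor y i n)))
    in aperiodic (shift-ultPeriodic x j (repeat⇒ultPeriodic y n determined i<i' same))
    where
    determined : ∀ {i i'} → factor y i n ≡ factor y i' n → y (i + n) ≡ y (i' + n)
    determined {i} {i'} eq with y (i + n) Fin.≟ y (i' + n)
    ... | yes same   = same
    ... | no  differ = ⊥-elim (none (factor y i n , length-factor y i n , y (i + n) , y (i' + n) , differ ,
          factor-∷ʳ-isFactor y i n , subst (λ v → IsFactor y (v ++ [ y (i' + n) ])) (sym eq) (factor-∷ʳ-isFactor y i' n)))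

  both-extensions-in-y : ∃[ v ] length v ≡ n × RightSpecial y v → IsFactor y (w ++ [ a ]) × IsFactor y (w ++ [ b ])
  both-extensions-in-y (v , ℓv , rs@(c , d , c≢d , fc , fd)) with refl ← rightSpecial-y-unique v ℓv rs
    with w-extensions c (isFactor-y⇒x fc) | w-extensions d (isFactor-y⇒x fd)
  ... | inj₁ refl | inj₁ refl = ⊥-elim (c≢d refl)
  ... | inj₁ refl | inj₂ refl = fc , fd
  ... | inj₂ refl | inj₁ refl = fd , fc
  ... | inj₂ refl | inj₂ refl = ⊥-elim (c≢d refl)

  -- By minimality of j the factor of length n+1 at j-1 does not occur in y; this propagates backwards.
  module _ (w-a-y : IsFactor y (w ++ [ a ])) (w-b-y : IsFactor y (w ++ [ b ])) where

    prefix-outside-y : ∀ q → ¬ IsFactor y (factor x q (suc n)) → ¬ IsFactor y (factor x q n)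
    prefix-outside-y q outside inside = outside (subst (IsFactor y) (sym (factor-∷ʳ x q n)) (extension-inside (c Fin.≟ d)))
      where
      v = factor x q n
      c = x (q + n)
      r = proj₁ (isFactor⇒factorOfLength y (length-factor x q n) inside)
      d = y (r + n)
      v-d : IsFactor y (v ++ [ d ])
      v-d = subst (λ u → IsFactor y (u ++ [ d ])) (proj₂ (isFactor⇒factorOfLength y (length-factor x q n) inside))
                  (factor-∷ʳ-isFactor y r n)
      extension-inside : Dec (c ≡ d) → IsFactor y (v ++ [ c ])
      extension-inside (yes c≡d) = subst (λ e → IsFactor y (v ++ [ e ])) (sym c≡d) v-d
      extension-inside (no c≢d)
        with v≡w ← rightSpecial-unique (length-factor x q n) length-w
                     (c , d , c≢d , factor-∷ʳ-isFactor x q n , isFactor-y⇒x v-d) w-rightSpecial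
        with w-extensions c (subst (λ u → IsFactor x (u ++ [ c ])) v≡w (factor-∷ʳ-isFactor x q n))
      ... | inj₁ c≡a = subst₂ (λ u e → IsFactor y (u ++ [ e ])) (sym v≡w) (sym c≡a) w-a-y
      ... | inj₂ c≡b = subst₂ (λ u e → IsFactor y (u ++ [ e ])) (sym v≡w) (sym c≡b) w-b-y

    last-before-j-recurrent : ∀ q → suc q ≡ j → IsFactor y (factor x q (suc n)) → MRecurrent (suc n) (shift x q)
    last-before-j-recurrent q q+1≡j inside v ℓv (i , eq) M =
      let i' , M≤i' , eq' = y-recurrent v ℓv (in-y i eq) M
      in suc i' , m≤n⇒m≤1+n M≤i' , trans (shift-suc i' (length v)) eq'
      where
      y-recurrent = proj₁ prefix
      shift-suc : ∀ i L → factorAt (shift x q) (suc i) L ≡ factorAt y i L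
      shift-suc i L = trans (factorAt-shift q (suc i) L)
        (trans (cong (λ p → factor x p L) (trans (+-suc q i) (cong (_+ i) q+1≡j))) (sym (factorAt-shift j i L)))
      in-y : ∀ i → factorAt (shift x q) i (length v) ≡ v → IsFactor y v
      in-y zero    eq = subst (IsFactor y)
        (trans (cong (λ p → factor x p (suc n)) (sym (+-identityʳ q)))
          (trans (sym (factorAt-shift q 0 (suc n))) (trans (cong (factorAt (shift x q) 0) (sym ℓv)) eq))) inside
      in-y (suc i) eq = i , trans (sym (shift-suc i _)) eq

    extension-not-in-y : ∀ d q → suc q + d ≡ j → ¬ IsFactor y (factor x q (suc n))
    extension-not-in-y zero q q+1≡j = proj₂ prefix q (subst (q <_) q+1≡j (m≤m+n (suc q) 0))
                                       ∘ last-before-j-recurrent q (trans (sym (+-identityʳ (suc q))) q+1≡j)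
    extension-not-in-y (suc d) q eq =
      prefix-outside-y (suc q) (extension-not-in-y d (suc q) (trans (sym (+-suc (suc q) d)) eq)) ∘ suffix-isFactor {y = y}

    not-in-y-before-j : ∀ q → q < j → ¬ IsFactor y (factor x q n)
    not-in-y-before-j q q<j = let d , j≡ = ∸-split q<j in prefix-outside-y q (extension-not-in-y d q (sym j≡))

  occurrence-in-y : ∀ c → IsFactor x (w ++ [ c ]) → ∃[ t ] factor y t n ≡ w × y (t + n) ≡ c
  occurrence-in-y c wc with p , p-w , p-c ← isFactor-∷ʳ⇒factor x length-w wc with j ≤? p
  ... | yes j≤p = let t , p≡ = ∸-split j≤p in
    t , trans (factor-shift x j t n) (subst (λ i → factor x i n ≡ w) p≡ p-w) ,
        trans (cong x (trans (sym (+-assoc j t n)) (cong (_+ n) (sym p≡)))) p-c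
  -- y is only known to have a right-special factor up to double negation, which suffices to refute p < j.
  ... | no  j≰p = ⊥-elim (y-has-rightSpecial λ rs →
    let w-a-y , w-b-y = both-extensions-in-y rs
    in not-in-y-before-j w-a-y w-b-y p (≰⇒> j≰p) (subst (IsFactor y) (sym p-w) (prefix-isFactor {y = y} w-a-y)))

+-rearrange : ∀ δ i n e → δ + (i + (n + e)) ≡ δ + i + e + n
+-rearrange = solve-∀

module ReducedRauzyGraph {k : ℕ} (x : InfWord k) (aperiodic : ¬ UltPeriodic x) (n m : ℕ) ⦃ _ : NonZero n ⦄
  (p[n] : HasComplexity x n m) (p[1+n] : HasComplexity x (suc n) (suc m))
  (j : ℕ) (prefix : IsPrefixLength (suc n) x j) where

  open RecurrentSuffix x aperiodic n m p[n] p[1+n] j prefix public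

  private
    occurrence-a = occurrence-in-y a w-a
    occurrence-b = occurrence-in-y b w-b

  module Graph = UniqueRightSpecial y n (proj₁ prefix) w length-w a b a≢b
               (proj₁ occurrence-a) (proj₁ (proj₂ occurrence-a)) (proj₂ (proj₂ occurrence-a))
               (proj₁ occurrence-b) (proj₁ (proj₂ occurrence-b)) (proj₂ (proj₂ occurrence-b))
               rightSpecial-y-unique (λ c → w-extensions c ∘ isFactor-y⇒x)

  open Graph using (e; p; u)

  -- The word read along the path from u to w.
  W : Word k
  W = factor y p (n + e)

  from-windows : ∀ {q} → (∀ z → z ≤ e → Graph.orbit q z ≡ Graph.orbit p z) → factor y q (n + e) ≡ W
  from-windows {q} agree = trans (cong (factor y q) (+-comm n e))
                                 (trans (factor-from-windows y e n agree) (cong (factor y p) (+-comm e n)))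

  W-from-u : ∀ {q} → factor y q n ≡ u → factor y q (n + e) ≡ W
  W-from-u = from-windows ∘ Graph.from-u

  W-to-w : ∀ {q} → factor y (q + e) n ≡ w → factor y q (n + e) ≡ W
  W-to-w = from-windows ∘ Graph.to-w

  W-suffix : ∀ {q} → factor y q (n + e) ≡ W → factor y (q + e) n ≡ w
  W-suffix {q} eq = trans (proj₂ (factor-split y q p e n (trans (cong (factor y q) (+-comm e n))
                                                         (trans eq (cong (factor y p) (+-comm n e))))))
                          Graph.u-to-w

  n+e-nonZero : NonZero (n + e)
  n+e-nonZero = >-nonZero (≤-trans (>-nonZero⁻¹ n) (m≤m+n n e))

  module Lengthened (j' : ℕ) (prefix' : IsPrefixLength (suc (n + e)) x j') where

    j≤j' : j ≤ j'
    j≤j' = ≮⇒≥ λ j'<j → proj₂ prefix j' j'<j (mRecurrent-shorter (shift x j') (suc n) e (proj₁ prefix'))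

    δ : ℕ
    δ = proj₁ (∸-split j≤j')

    y' : InfWord k
    y' = shift x j'

    j'+ : ∀ i → j' + i ≡ j + (δ + i)
    j'+ i = trans (cong (_+ i) (proj₂ (∸-split j≤j'))) (+-assoc j δ i)

    y'-factor : ∀ i L → factor y' i L ≡ factor y (δ + i) L
    y'-factor i L = trans (factor-shift x j' i L) (trans (cong (λ q → factor x q L) (j'+ i)) (sym (factor-shift x j (δ + i) L)))

    y'-letter : ∀ i → y' i ≡ y (δ + i)
    y'-letter i = cong x (j'+ i)

    y'-letter-after : ∀ i → y' (i + (n + e)) ≡ y (δ + i + e + n)
    y'-letter-after i = cong x (trans (j'+ (i + (n + e))) (cong (j +_) (+-rearrange δ i n e)))

    leftSpecial-y'-unique : ∀ v → length v ≡ n + e → LeftSpecial y' v → v ≡ W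
    leftSpecial-y'-unique v ℓv (c , d , c≢d , fc , fd) =
      trans (sym (at i i-v)) (W-from-u (Graph.leftSpecial-unique _ (length-factor y _ n) prefix-leftSpecial))
      where
      i   = proj₁ (isFactor-∷⇒factor y' ℓv fc)
      i-c = proj₁ (proj₂ (isFactor-∷⇒factor y' ℓv fc))
      i-v = proj₂ (proj₂ (isFactor-∷⇒factor y' ℓv fc))
      i'   = proj₁ (isFactor-∷⇒factor y' ℓv fd)
      i'-d = proj₁ (proj₂ (isFactor-∷⇒factor y' ℓv fd))
      i'-v = proj₂ (proj₂ (isFactor-∷⇒factor y' ℓv fd))
      at : ∀ i → factor y' (suc i) (n + e) ≡ v → factor y (suc (δ + i)) (n + e) ≡ v
      at i eq = trans (cong (λ q → factor y q (n + e)) (sym (+-suc δ i))) (trans (sym (y'-factor (suc i) (n + e))) eq)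
      same-prefix : factor y (suc (δ + i)) n ≡ factor y (suc (δ + i')) n
      same-prefix = proj₁ (factor-split y _ _ n e (trans (at i i-v) (sym (at i' i'-v))))
      prefix-leftSpecial : LeftSpecial y (factor y (suc (δ + i)) n)
      prefix-leftSpecial = y (δ + i) , y (δ + i') ,
        (λ eq → c≢d (trans (sym i-c) (trans (y'-letter i) (trans eq (trans (sym (y'-letter i')) i'-d))))) ,
        factor-isFactor y (δ + i) (suc n) ,
        subst (λ v → IsFactor y (y (δ + i') ∷ v)) (sym same-prefix) (factor-isFactor y (δ + i') (suc n))

    rightSpecial-y'-unique : ∀ v → length v ≡ n + e → RightSpecial y' v → v ≡ W
    rightSpecial-y'-unique v ℓv (c , d , c≢d , fc , fd) =
      trans (sym (at fc)) (W-to-w (rightSpecial-y-unique _ (length-factor y _ n) suffix-rightSpecial))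
      where
      i  = proj₁ (isFactor-∷ʳ⇒factor y' ℓv fc)
      i' = proj₁ (isFactor-∷ʳ⇒factor y' ℓv fd)
      at : ∀ {c} (fc : IsFactor y' (v ++ [ c ])) → factor y (δ + proj₁ (isFactor-∷ʳ⇒factor y' ℓv fc)) (n + e) ≡ v
      at fc = trans (sym (y'-factor _ (n + e))) (proj₁ (proj₂ (isFactor-∷ʳ⇒factor y' ℓv fc)))
      same-suffix : factor y (δ + i + e) n ≡ factor y (δ + i' + e) n
      same-suffix = proj₂ (factor-split y (δ + i) (δ + i') e n
        (subst (λ L → factor y (δ + i) L ≡ factor y (δ + i') L) (+-comm n e) (trans (at fc) (sym (at fd)))))
      letter : ∀ {c} (fc : IsFactor y' (v ++ [ c ])) → y (δ + proj₁ (isFactor-∷ʳ⇒factor y' ℓv fc) + e + n) ≡ c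
      letter fc = trans (sym (y'-letter-after _)) (proj₂ (proj₂ (isFactor-∷ʳ⇒factor y' ℓv fc)))
      suffix-rightSpecial : RightSpecial y (factor y (δ + i + e) n)
      suffix-rightSpecial = y (δ + i + e + n) , y (δ + i' + e + n) ,
        (λ eq → c≢d (trans (sym (letter fc)) (trans eq (letter fd)))) ,
        factor-∷ʳ-isFactor y (δ + i + e) n ,
        subst (λ v → IsFactor y (v ++ [ y (δ + i' + e + n) ])) (sym same-suffix) (factor-∷ʳ-isFactor y (δ + i' + e) n)

    W-extensions-y' : ∀ c → IsFactor y' (W ++ [ c ]) → c ≡ a ⊎ c ≡ b
    W-extensions-y' c f =
      let i , i-W , i-c = isFactor-∷ʳ⇒factor y' (length-factor y p (n + e)) f
          suffix-w = W-suffix (trans (sym (y'-factor i (n + e))) i-W)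
      in w-extensions c (isFactor-y⇒x (subst₂ (λ v c → IsFactor y (v ++ [ c ])) suffix-w
                                         (trans (sym (y'-letter-after i)) i-c) (factor-∷ʳ-isFactor y (δ + i + e) n)))

    W-occurrence : ∀ {t c} → factor y t n ≡ w → y (t + n) ≡ c → ∃[ t' ] factor y' t' (n + e) ≡ W × y' (t' + (n + e)) ≡ c
    W-occurrence {t} t-w t-c =
      let q , δ+e≤q , q-w , q-letter = Graph.recurs t (δ + e)
          t' , q≡ = ∸-split δ+e≤q
          position : δ + t' + e ≡ q
          position = trans (+-assoc δ t' e) (trans (cong (δ +_) (+-comm t' e)) (trans (sym (+-assoc δ e t')) (sym q≡)))
      in t' , trans (y'-factor t' (n + e)) (W-to-w (trans (cong (λ r → factor y r n) position) (trans q-w t-w))) ,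
         trans (y'-letter-after t') (trans (cong (λ r → y (r + n)) position) (trans q-letter t-c))

    private
      occurrence-a' = W-occurrence (proj₁ (proj₂ occurrence-a)) (proj₂ (proj₂ occurrence-a))
      occurrence-b' = W-occurrence (proj₁ (proj₂ occurrence-b)) (proj₂ (proj₂ occurrence-b))

    module Graph' = UniqueRightSpecial y' (n + e) ⦃ n+e-nonZero ⦄ (proj₁ prefix') W (length-factor y p (n + e)) a b a≢b
                  (proj₁ occurrence-a') (proj₁ (proj₂ occurrence-a')) (proj₂ (proj₂ occurrence-a'))
                  (proj₁ occurrence-b') (proj₁ (proj₂ occurrence-b')) (proj₂ (proj₂ occurrence-b'))
                  rightSpecial-y'-unique W-extensions-y'

    infShape : InfShape y' (n + e)
    infShape = let W' , shape , _ = Graph'.leftSpecial-w⇒formA leftSpecial-y'-unique in W' , shape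

lemma2p12 : (k : ℕ) (x : InfWord k) → ¬ UltPeriodic x →
    (n : ℕ) → 1 ≤ n →
    (m : ℕ) → HasComplexity x n m → HasComplexity x (suc n) (suc m) →
    (j : ℕ) → IsPrefixLength (suc n) x j →
    FormA (shift x j) n
    ⊎ (FormB (shift x j) n ×
       Σ ℕ (λ d → 0 < d ×
         ((j' : ℕ) → IsPrefixLength (suc (n + d)) x j' →
           InfShape (shift x j') (n + d))))
lemma2p12 k x aperiodic n 1≤n m p[n] p[1+n] j prefix = case Graph.e ≟ 0 of λ where
    (yes e≡0) → inj₁ (Graph.formA e≡0)
    (no  e≢0) → inj₂ (Graph.formB (n≢0⇒n>0 e≢0) , Graph.e , n≢0⇒n>0 e≢0 , Lengthened.infShape)
  where open ReducedRauzyGraph x aperiodic n m ⦃ >-nonZero 1≤n ⦄ p[n] p[1+n] j prefix
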